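{- Let $k$ be a positive integer and $n$ an even positive integer. If $G$ is a connected graph on $n$ vertices with $|E(G)|\geqslant\binom{n-1}{2}+2k$, then $G$ is $k$-extendable, unless $G$ is isomorphic to $K_{2k}\vee(K_{n-2k-1}\cup K_1)$ or to $K_{2k+1}\vee 3K_1$.
   Context: All graphs are finite, simple and undirected. A matching is a set of pairwise vertex-disjoint edges; it is perfect if it covers all vertices. A graph with at least $2k+2$ vertices that has a perfect matching is called $k$-extendable if every matching of size $k$ is contained in some perfect matching. $K_r$ is the complete graph on $r$ vertices; $tK_1$ is the edgeless graph on $t$ vertices; $G_1\cup G_2$ is the disjoint union; the join $G_1\vee G_2$ is obtained from $G_1\cup G_2$ by adding all edges between $V(G_1)$ and $V(G_2)$. -}

module Defs where

open import Data.Nat using (ℕ; zero; suc; _+_; _*_; _∸_; _<_; _<ᵇ_; _≥_)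
open import Data.Fin using (Fin; toℕ; _<?_)
open import Data.Bool using (Bool; true; false; _∧_; _∨_; not)
open import Data.List using (List; []; _∷_; length; filter; cartesianProduct; concatMap)
open import Data.List.Membership.Propositional using (_∈_)
open import Data.List.Relation.Unary.All using (All)
open import Data.List.Relation.Unary.Unique.Propositional using (Unique)
open import Data.Product using (_×_; _,_; proj₁; proj₂; Σ; ∃)
open import Data.Sum using (_⊎_)
open import Data.Fin using (_≟_)
open import Relation.Nullary.Decidable using (⌊_⌋)
open import Relation.Binary.PropositionalEquality using (_≡_)
open import Function.Bundles using (_↔_; Inverse)
open import Data.List using (allFin) renaming ([_] to [_]ₗ)

record Graph (n : ℕ) : Set where
  field
    adj    : Fin n → Fin n → Bool
    symm   : ∀ i j → adj i j ≡ adj j i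
    irrefl : ∀ i → adj i i ≡ false
open Graph public

edges : ∀ {n} → Graph n → List (Fin n × Fin n)
edges {n} G = filter (λ p → ⌊ proj₁ p <? proj₂ p ⌋ ∧ adj G (proj₁ p) (proj₂ p) Data.Bool.≟ true)
                     (cartesianProduct (allFin n) (allFin n))

numEdges : ∀ {n} → Graph n → ℕ
numEdges G = length (edges G)

data Walk {n} (G : Graph n) : Fin n → Fin n → Set where
  here : ∀ {u} → Walk G u u
  step : ∀ {u w v} → adj G u w ≡ true → Walk G w v → Walk G u v

Connected : ∀ {n} → Graph n → Set
Connected {n} G = ∀ (u v : Fin n) → Walk G u v

-- Matchings: lists of edges (ordered pairs standing for unordered edges)
-- whose endpoints are pairwise distinct (so edges are pairwise vertex-disjoint).
endpoints : ∀ {n} → List (Fin n × Fin n) → List (Fin n)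
endpoints = concatMap (λ e → proj₁ e ∷ proj₂ e ∷ [])

IsMatching : ∀ {n} → Graph n → List (Fin n × Fin n) → Set
IsMatching G M = All (λ e → adj G (proj₁ e) (proj₂ e) ≡ true) M × Unique (endpoints M)

IsPerfectMatching : ∀ {n} → Graph n → List (Fin n × Fin n) → Set
IsPerfectMatching {n} G M = IsMatching G M × (∀ (v : Fin n) → v ∈ endpoints M)

_⊆ₘ_ : ∀ {n} → List (Fin n × Fin n) → List (Fin n × Fin n) → Set
M ⊆ₘ M' = All (λ e → (proj₁ e , proj₂ e) ∈ M' ⊎ (proj₂ e , proj₁ e) ∈ M') M

HasPerfectMatching : ∀ {n} → Graph n → Set
HasPerfectMatching G = ∃ λ M → IsPerfectMatching G M

KExtendable : ∀ {n} → ℕ → Graph n → Set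
KExtendable {n} k G =
  n ≥ 2 * k + 2 × HasPerfectMatching G ×
  (∀ M → IsMatching G M → length M ≡ k →
     ∃ λ M' → IsPerfectMatching G M' × M ⊆ₘ M')

-- The target graph is given by its
-- adjacency function (the concrete graphs below are symmetric and irreflexive).
_≅_ : ∀ {n} → Graph n → (Fin n → Fin n → Bool) → Set
_≅_ {n} G h = Σ (Fin n ↔ Fin n) λ f →
  ∀ i j → adj G i j ≡ h (Inverse.to f i) (Inverse.to f j)

private
  neq : ∀ {n} → Fin n → Fin n → Bool
  neq i j = not ⌊ i ≟ j ⌋

-- K_{2k} ∨ (K_{n-2k-1} ∪ K_1) on Fin n: vertices 0..n-2 form a clique
-- (= K_{2k} ∨ K_{n-2k-1}); the last vertex n-1 is adjacent exactly to 0..2k-1.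
Exc1 : (n k : ℕ) → Fin n → Fin n → Bool
Exc1 n k i j = neq i j ∧ ((((toℕ i <ᵇ (n ∸ 1)) ∧ (toℕ j <ᵇ (n ∸ 1))) ∨ (toℕ i <ᵇ 2 * k) ∨ (toℕ j <ᵇ 2 * k)))

-- K_a ∨ (n-a)K_1 on Fin n: vertices 0..a-1 form a clique joined to an
-- independent set on the remaining vertices.
CliqueJoinIndep : (n a : ℕ) → Fin n → Fin n → Bool
CliqueJoinIndep n a i j = neq i j ∧ ((toℕ i <ᵇ a) ∨ (toℕ j <ᵇ a))

module Submission where

-- Write n = 2k + 2(h + 1) and count non-adjacent pairs through co-degrees (their sum is twice the number of
-- edges missing from G).  The edge bound leaves at most 2h + 1 = n - 1 - 2k missing edges.  Deleting the
-- vertices of a k-matching leaves a set R of 2(h + 1) vertices with at most |R| - 1 missing edges.  With at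
-- most |R| - 2 missing edges G[R] has a perfect matching: some edge uv meets at least two missing edges, or
-- all of them, and deleting u and v preserves the bound.  With exactly |R| - 1 missing edges the only
-- obstructions are a vertex isolated in G[R], or |R| = 4 and three mutually non-adjacent vertices.  The first
-- spends all 2h + 1 missing edges at one vertex, so G is K_2k ∨ (K_(n-2k-1) ∪ K_1); the second forces h = 1
-- and a missing triangle, so G is K_(2k+1) ∨ 3K_1.

open import Defs
open import Data.Nat using (ℕ; _+_; _*_; _∸_; _≥_; NonZero)
open import Data.Nat.Combinatorics using (_C_)
open import Data.Nat.Divisibility using (_∣_)
open import Data.Sum using (_⊎_)
open import Data.Product using (_×_)
open import Relation.Binary.PropositionalEquality using (_≡_)

open import Data.Bool using (true; false; not; _∧_; _∨_)
import Data.Bool as Bool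
open import Data.Bool.Properties using (¬-not; ⇔→≡; T-≡; ∨-identityʳ)
open import Data.Fin using (Fin; toℕ; _<?_)
import Data.Fin as Fin
open import Data.Fin.Properties using (toℕ<n; toℕ-injective; toℕ-cast; cast-involutive)
open import Data.List using (List; []; _∷_; [_]; _++_; length; map; filter; cartesianProduct; allFin; tabulate; lookup)
open import Data.List.Membership.Propositional using (_∈_; _∉_; find; lose)
open import Data.List.Membership.Propositional.Properties
  using (∈-filter⁺; ∈-filter⁻; ∈-map⁻; ∈-cartesianProduct⁺; ∈-cartesianProduct⁻; ∈-length; ∈-lookup; ∈-allFin;
         ∈-++⁺ˡ; ∈-++⁺ʳ; ∈-++⁻)
open import Data.List.Membership.Propositional.Properties.WithK using (unique⇒irrelevant)
open import Data.List.Properties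
  using (++-assoc; concatMap-++; filter-none; map-cong; map-tabulate; length-tabulate; length-map; length-++; filter-++;
         filter-notAll; filter-all; filter-accept; filter-reject; filter-≐)
open import Data.List.Relation.Binary.Permutation.Propositional using (_↭_; ↭-refl; ↭-trans; ↭-prep; ↭-swap)
open import Data.List.Relation.Binary.Permutation.Propositional.Properties using (↭-length; filter-↭)
import Data.List.Relation.Binary.Permutation.Propositional.Properties as Perm
open import Data.List.Relation.Binary.Subset.Propositional using (_⊆_)
open import Data.List.Relation.Unary.All using (All; []; _∷_)
import Data.List.Relation.Unary.All as All
import Data.List.Relation.Unary.All.Properties as All
open import Data.List.Relation.Unary.Any using (Any; here; there; any?)
import Data.List.Relation.Unary.Any as Any
open import Data.List.Relation.Unary.Any.Properties using (lookup-index)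
open import Data.List.Relation.Unary.Unique.Propositional using (Unique; []; _∷_)
import Data.List.Relation.Unary.Unique.Propositional.Properties as Unique
open import Data.Nat using (zero; suc; _≤_; _<_; _<ᵇ_; z≤n; s≤s; s≤s⁻¹; _≤?_)
import Data.Nat as ℕ
open import Data.Nat.Combinatorics using (nC1≡n; nCk+nC[k+1]≡[n+1]C[k+1])
open import Data.Nat.Divisibility using (divides)
open import Data.Nat.ListAction using (sum)
open import Data.Nat.ListAction.Properties using (sum-↭)
open import Data.Nat.Properties hiding (_<?_; _≟_; _≤?_)
open import Data.Nat.Tactic.RingSolver using (solve-∀)
open import Data.Product using (_,_; proj₁; proj₂; ∃; swap)
open import Data.Product.Properties using (≡-dec)
open import Data.Sum using (inj₁; inj₂)
open import Function using (id; _∘_; case_of_; _⇔_; mk⇔; Equivalence; _↔_; Inverse; mk↔ₛ′)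
open import Relation.Binary.Definitions using (DecidableEquality)
open import Relation.Binary.PropositionalEquality
  using (_≢_; refl; sym; trans; cong; cong₂; subst; subst₂; module ≡-Reasoning)
open import Relation.Nullary using (¬_; Dec; yes; no; contradiction)
open import Relation.Nullary.Decidable using (⌊_⌋; ¬?; _×-dec_; _⊎-dec_)
open import Relation.Unary using (Pred; Decidable; _≐_)

⌊⌋∧≡true : ∀ {p} {P : Set p} (d : Dec P) {b} → ⌊ d ⌋ Bool.∧ b ≡ true → P × b ≡ true
⌊⌋∧≡true (yes p) b≡true = p , b≡true
⌊⌋∧≡true (no _) ()

≡true-⌊⌋∧ : ∀ {p} {P : Set p} (d : Dec P) {b} → P → b ≡ true → ⌊ d ⌋ Bool.∧ b ≡ true
≡true-⌊⌋∧ (yes _) _ b≡true = b≡true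
≡true-⌊⌋∧ (no ¬p) p _ = contradiction p ¬p

⌊⌋-cong : ∀ {p q} {P : Set p} {Q : Set q} → P ⇔ Q → (P? : Dec P) (Q? : Dec Q) → ⌊ P? ⌋ ≡ ⌊ Q? ⌋
⌊⌋-cong _ (yes _) (yes _) = refl
⌊⌋-cong _ (no _) (no _) = refl
⌊⌋-cong P⇔Q (yes p) (no ¬q) = contradiction (Equivalence.to P⇔Q p) ¬q
⌊⌋-cong P⇔Q (no ¬p) (yes q) = contradiction (Equivalence.from P⇔Q q) ¬p

not⌊⌋≡true⇔ : ∀ {p} {P : Set p} (P? : Dec P) → (not ⌊ P? ⌋ ≡ true) ⇔ (¬ P)
not⌊⌋≡true⇔ (yes p) = mk⇔ (λ ()) (λ ¬p → contradiction p ¬p)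
not⌊⌋≡true⇔ (no ¬p) = mk⇔ (λ _ → ¬p) (λ _ → refl)

<ᵇ≡ : ∀ {m k b} → (m < k) ⇔ (b ≡ true) → (m <ᵇ k) ≡ b
<ᵇ≡ {m} {k} m<k⇔b = ⇔→≡ {z = true} (mk⇔
  (λ m<ᵇk → Equivalence.to m<k⇔b (<ᵇ⇒< m k (Equivalence.from T-≡ m<ᵇk)))
  (λ b≡true → Equivalence.to T-≡ (<⇒<ᵇ (Equivalence.from m<k⇔b b≡true))))

m+4≰2+m : ∀ m → ¬ (m + 4 ≤ 2 + m)
m+4≰2+m m m+4≤2+m = contradiction (+-cancelʳ-≤ m 4 2 (subst₂ _≤_ (+-comm m 4) refl m+4≤2+m)) λ { (s≤s (s≤s ())) }

2*h+1+1≡2*suc-h : ∀ h → suc (2 * h) + 1 ≡ 2 * suc h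
2*h+1+1≡2*suc-h = solve-∀

C2-pred : ∀ {n} → 1 ≤ n → n C 2 ≡ (n ∸ 1) C 2 + (n ∸ 1)
C2-pred {suc n} _ = trans (sym (nCk+nC[k+1]≡[n+1]C[k+1] n 1)) (trans (cong (_+ n C 2) (nC1≡n n)) (+-comm n (n C 2)))

even-parameters : ∀ {d k n q} → n ≡ q * 2 → 1 ≤ n → d + 2 * (2 * k) ≤ 2 * (n ∸ 1) →
  ∃ λ h → n ≡ 2 * k + 2 * suc h × d ≤ 2 * suc (2 * h)
even-parameters {d} {k} {n} {q} n≡q*2 1≤n bound = h , n≡ , d≤
  where
  2k+1≤n : 2 * k + 1 ≤ n
  2k+1≤n = ≤-trans (+-monoˡ-≤ 1 (*-cancelˡ-≤ 2 (≤-trans (m≤n+m _ d) bound))) (≤-reflexive (m∸n+n≡m 1≤n))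
  k<q : k < q
  k<q = *-cancelˡ-< 2 k q (subst₂ _≤_ (+-comm (2 * k) 1) (trans n≡q*2 (*-comm q 2)) 2k+1≤n)
  h : ℕ
  h = q ∸ suc k
  n≡ : n ≡ 2 * k + 2 * suc h
  n≡ = trans n≡q*2 (trans (cong (_* 2) (sym (m+[n∸m]≡n k<q))) (rearrange k h))
    where
    rearrange : ∀ k h → (suc k + h) * 2 ≡ 2 * k + 2 * suc h
    rearrange = solve-∀
  d≤ : d ≤ 2 * suc (2 * h)
  d≤ = +-cancelʳ-≤ (2 * (2 * k)) d (2 * suc (2 * h)) (subst (d + 2 * (2 * k) ≤_)
    (trans (cong (λ m → 2 * (m ∸ 1)) (trans n≡ (as-suc k h))) (rearrange k h)) bound)
    where
    as-suc : ∀ k h → 2 * k + 2 * suc h ≡ suc (2 * k + suc (2 * h))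
    as-suc = solve-∀
    rearrange : ∀ k h → 2 * (2 * k + suc (2 * h)) ≡ 2 * suc (2 * h) + 2 * (2 * k)
    rearrange = solve-∀

triangle-bounds : ∀ {a b c} → 4 ≤ a → 2 ≤ b → a + (b + c) ≤ 6 → a ≤ 4 × b ≤ 2 × c ≡ 0
triangle-bounds {a} {b} {c} 4≤a 2≤b sum≤6 =
    +-cancelʳ-≤ 2 a 4 (≤-trans (+-monoʳ-≤ a (≤-trans 2≤b (m≤m+n b c))) sum≤6)
  , +-cancelˡ-≤ 4 b 2 (≤-trans (+-mono-≤ 4≤a (m≤m+n b c)) sum≤6)
  , n≤0⇒n≡0 (+-cancelˡ-≤ 6 c 0 (≤-trans (+-mono-≤ 4≤a (+-monoˡ-≤ c 2≤b)) sum≤6))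

2*2*suc≡4*m+4 : ∀ m → 2 * (2 * suc m) ≡ 4 * m + 4
2*2*suc≡4*m+4 = solve-∀

4*m<2*suc-m⇒m≡0 : ∀ {m} → 4 * m < 2 * suc m → m ≡ 0
4*m<2*suc-m⇒m≡0 {zero} _ = refl
4*m<2*suc-m⇒m≡0 {suc m} 4m<2[m+1] = contradiction (subst (_≤ 2 * suc (suc m)) (eq m) 4m<2[m+1]) (m+1+n≰m _)
  where
  eq : ∀ m → suc (4 * suc m) ≡ 2 * suc (suc m) + suc (2 * m)
  eq = solve-∀

1≤2*n⇒1≤n : ∀ {n} → 1 ≤ 2 * n → 1 ≤ n
1≤2*n⇒1≤n {suc n} _ = s≤s z≤n

3≤2*suc-m⇒1≤m : ∀ {m} → 3 ≤ 2 * suc m → 1 ≤ m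
3≤2*suc-m⇒1≤m {zero} (s≤s (s≤s ()))
3≤2*suc-m⇒1≤m {suc m} _ = s≤s z≤n

4*m<6⇒m≤1 : ∀ {m} → 4 * m < 6 → m ≤ 1
4*m<6⇒m≤1 {zero} _ = z≤n
4*m<6⇒m≤1 {suc zero} _ = s≤s z≤n
4*m<6⇒m≤1 {suc (suc m)} 4m<6 = contradiction (≤-trans (s≤s (*-monoʳ-≤ 4 {2} (s≤s (s≤s z≤n)))) 4m<6)
  λ { (s≤s (s≤s (s≤s (s≤s (s≤s (s≤s ())))))) }

2*suc[2h]≤4*[k+h] : ∀ {k} h → 1 ≤ k → 2 * suc (2 * h) ≤ 4 * (k + h)
2*suc[2h]≤4*[k+h] {k} h 1≤k = begin
  2 * suc (2 * h)     ≤⟨ m≤m+n _ 2 ⟩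
  2 * suc (2 * h) + 2 ≡⟨ rearrange h ⟩
  4 * (1 + h)         ≤⟨ *-monoʳ-≤ 4 (+-monoˡ-≤ h 1≤k) ⟩
  4 * (k + h)         ∎
  where
  open ≤-Reasoning
  rearrange : ∀ h → 2 * suc (2 * h) + 2 ≡ 4 * (1 + h)
  rearrange = solve-∀

m+4≤4*n⇒m≤4*[n∸1] : ∀ {m n} → m + 4 ≤ 4 * n → m ≤ 4 * (n ∸ 1)
m+4≤4*n⇒m≤4*[n∸1] {m} {n} m+4≤4n = subst (m ≤_) (sym (*-distribˡ-∸ 4 n 1)) (m+n≤o⇒m≤o∸n m m+4≤4n)

module _ {a p q} {A : Set a} {P : Pred A p} {Q : Pred A q} (P? : Decidable P) (Q? : Decidable Q) where

  length-filter-split : ∀ xs →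
    length (filter P? xs) ≡ length (filter (λ x → P? x ×-dec Q? x) xs) + length (filter (λ x → P? x ×-dec ¬? (Q? x)) xs)
  length-filter-split [] = refl
  length-filter-split (x ∷ xs) with P? x | Q? x
  ... | no _  | _     = length-filter-split xs
  ... | yes _ | yes _ = cong suc (length-filter-split xs)
  ... | yes _ | no _  = trans (cong suc (length-filter-split xs)) (sym (+-suc _ _))

  length-filter-≐ : P ≐ Q → ∀ xs → length (filter P? xs) ≡ length (filter Q? xs)
  length-filter-≐ P≐Q xs = cong length (filter-≐ P? Q? P≐Q xs)

module _ {a b p} {A : Set a} {B : Set b} {P : Pred B p} (P? : Decidable P) where

  length-filter-map : ∀ (f : A → B) xs → length (filter P? (map f xs)) ≡ length (filter (P? ∘ f) xs)
  length-filter-map f [] = refl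
  length-filter-map f (x ∷ xs) with P? (f x)
  ... | yes _ = cong suc (length-filter-map f xs)
  ... | no _  = length-filter-map f xs

module _ {a b p} {A : Set a} {B : Set b} {P : Pred (A × B) p} (P? : Decidable P) where

  length-filter-cartesianProduct : ∀ xs ys →
    length (filter P? (cartesianProduct xs ys)) ≡ sum (map (λ x → length (filter (λ y → P? (x , y)) ys)) xs)
  length-filter-cartesianProduct [] ys = refl
  length-filter-cartesianProduct (x ∷ xs) ys = begin
    length (filter P? (map (x ,_) ys ++ cartesianProduct xs ys))
      ≡⟨ cong length (filter-++ P? (map (x ,_) ys) _) ⟩
    length (filter P? (map (x ,_) ys) ++ filter P? (cartesianProduct xs ys))
      ≡⟨ length-++ (filter P? (map (x ,_) ys)) ⟩
    length (filter P? (map (x ,_) ys)) + length (filter P? (cartesianProduct xs ys))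
      ≡⟨ cong₂ _+_ (length-filter-map P? (x ,_) ys) (length-filter-cartesianProduct xs ys) ⟩
    _ ∎
    where open ≡-Reasoning

search : ∀ {a p} {A : Set a} {P : Pred A p} → Decidable P → ∀ xs →
  (∃ λ x → x ∈ xs × P x) ⊎ (∀ {x} → x ∈ xs → ¬ P x)
search P? xs with any? P? xs
... | yes some = inj₁ (find some)
... | no none = inj₂ (λ x∈xs px → none (lose x∈xs px))

length-filter≡sum-singletons : ∀ {a p} {A : Set a} {P : Pred A p} (P? : Decidable P) xs →
  length (filter P? xs) ≡ sum (map (λ x → length (filter P? [ x ])) xs)
length-filter≡sum-singletons P? [] = refl
length-filter≡sum-singletons P? (x ∷ xs) with P? x
... | yes _ = cong suc (length-filter≡sum-singletons P? xs)
... | no _ = length-filter≡sum-singletons P? xs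

length-filter-singleton-cong : ∀ {a p q} {A : Set a} {P : Pred A p} {Q : Pred A q} (P? : Decidable P) (Q? : Decidable Q)
  {x y} → (P x → Q y) → (Q y → P x) → length (filter P? [ x ]) ≡ length (filter Q? [ y ])
length-filter-singleton-cong P? Q? {x} {y} P⇒Q Q⇒P with P? x | Q? y
... | yes _ | yes _ = refl
... | no _ | no _ = refl
... | yes px | no ¬qy = contradiction (P⇒Q px) ¬qy
... | no ¬px | yes qy = contradiction (Q⇒P qy) ¬px

≤-sum-map : ∀ {a} {A : Set a} (f : A → ℕ) {x xs} → x ∈ xs → f x ≤ sum (map f xs)
≤-sum-map f (here refl) = m≤m+n _ _
≤-sum-map f {xs = y ∷ _} (there x∈xs) = ≤-trans (≤-sum-map f x∈xs) (m≤n+m _ (f y))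

sum-map-+ : ∀ {a} {A : Set a} (f g : A → ℕ) xs → sum (map (λ x → f x + g x) xs) ≡ sum (map f xs) + sum (map g xs)
sum-map-+ f g [] = refl
sum-map-+ f g (x ∷ xs) = trans (cong (f x + g x +_) (sum-map-+ f g xs)) (+-interchange (f x) (g x) _ _)
  where open import Algebra.Properties.CommutativeSemigroup +-commutativeSemigroup renaming (interchange to +-interchange)

sum-map-≤ : ∀ {a} {A : Set a} (f : A → ℕ) {c} xs → (∀ {x} → x ∈ xs → f x ≤ c) → sum (map f xs) ≤ length xs * c
sum-map-≤ f [] _ = z≤n
sum-map-≤ f (x ∷ xs) f≤c = +-mono-≤ (f≤c (here refl)) (sum-map-≤ f xs (f≤c ∘ there))

sum-map-≡0 : ∀ {a} {A : Set a} (f : A → ℕ) xs → (∀ {x} → x ∈ xs → f x ≡ 0) → sum (map f xs) ≡ 0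
sum-map-≡0 f xs f≡0 = n≤0⇒n≡0 (subst (sum (map f xs) ≤_) (*-zeroʳ (length xs)) (sum-map-≤ f xs (≤-reflexive ∘ f≡0)))

module DecidableListSets {a} {A : Set a} (_≟_ : DecidableEquality A) where

  open import Data.List.Membership.DecPropositional _≟_ public using (_∈?_)

  infixl 5 _∖_
  _∖_ : List A → A → List A
  xs ∖ x = filter (λ y → ¬? (y ≟ x)) xs

  ∈-∖⁻ : ∀ {x y} xs → y ∈ xs ∖ x → y ∈ xs × y ≢ x
  ∈-∖⁻ xs = ∈-filter⁻ (λ y → ¬? (y ≟ _)) {xs = xs}

  ∈-∖⁺ : ∀ {x y xs} → y ∈ xs → y ≢ x → y ∈ xs ∖ x
  ∈-∖⁺ = ∈-filter⁺ (λ y → ¬? (y ≟ _))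

  ∖-⊆ : ∀ {x xs} → xs ∖ x ⊆ xs
  ∖-⊆ {xs = xs} = proj₁ ∘ ∈-∖⁻ xs

  ∖-unique : ∀ {x xs} → Unique xs → Unique (xs ∖ x)
  ∖-unique = Unique.filter⁺ (λ y → ¬? (y ≟ _))

  ∖-length-< : ∀ {x xs} → x ∈ xs → length (xs ∖ x) < length xs
  ∖-length-< {xs = xs} x∈xs = filter-notAll (λ y → ¬? (y ≟ _)) xs (Any.map (λ x≡y y≢x → y≢x (sym x≡y)) x∈xs)

  ∖-∉ : ∀ {x xs} → x ∉ xs → xs ∖ x ≡ xs
  ∖-∉ x∉xs = filter-all (λ y → ¬? (y ≟ _)) (All.tabulate (λ y∈xs y≡x → x∉xs (subst (_∈ _) y≡x y∈xs)))

  infixl 5 _∖∖_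
  _∖∖_ : List A → List A → List A
  xs ∖∖ [] = xs
  xs ∖∖ (y ∷ ys) = (xs ∖ y) ∖∖ ys

  ∈-∖∖⁻ : ∀ {x} xs ys → x ∈ xs ∖∖ ys → x ∈ xs × x ∉ ys
  ∈-∖∖⁻ xs [] x∈ = x∈ , λ ()
  ∈-∖∖⁻ xs (y ∷ ys) x∈ with ∈-∖∖⁻ (xs ∖ y) ys x∈
  ... | x∈xs∖y , x∉ys with ∈-∖⁻ xs x∈xs∖y
  ...   | x∈xs , x≢y = x∈xs , λ { (here x≡y) → x≢y x≡y ; (there x∈ys) → x∉ys x∈ys }

  ∈-∖∖⁺ : ∀ {x xs} ys → x ∈ xs → x ∉ ys → x ∈ xs ∖∖ ys
  ∈-∖∖⁺ [] x∈xs _ = x∈xs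
  ∈-∖∖⁺ (y ∷ ys) x∈xs x∉ = ∈-∖∖⁺ ys (∈-∖⁺ x∈xs (x∉ ∘ here)) (x∉ ∘ there)

  ∖∖-unique : ∀ {xs} ys → Unique xs → Unique (xs ∖∖ ys)
  ∖∖-unique [] u = u
  ∖∖-unique (y ∷ ys) u = ∖∖-unique ys (∖-unique u)

  ↭-∷-∖ : ∀ {x xs} → Unique xs → x ∈ xs → xs ↭ x ∷ (xs ∖ x)
  ↭-∷-∖ {x} {y ∷ xs} (y∉xs ∷ u) (here refl) rewrite filter-reject (λ z → ¬? (z ≟ x)) {xs = xs} (λ ¬x≡x → ¬x≡x refl) =
    ↭-prep x (subst (xs ↭_) (sym (∖-∉ (λ x∈xs → All.lookup y∉xs x∈xs refl))) ↭-refl)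
  ↭-∷-∖ {x} {y ∷ xs} (y∉xs ∷ u) (there x∈xs) rewrite filter-accept (λ z → ¬? (z ≟ x)) {xs = xs} (All.lookup y∉xs x∈xs) =
    ↭-trans (↭-prep y (↭-∷-∖ u x∈xs)) (↭-swap y x ↭-refl)

  unique-⊆⇒length-≤ : ∀ {xs ys} → Unique xs → xs ⊆ ys → length xs ≤ length ys
  unique-⊆⇒length-≤ {[]} _ _ = z≤n
  unique-⊆⇒length-≤ {x ∷ xs} {ys} (x∉xs ∷ u) xs⊆ys = ≤-trans
    (s≤s (unique-⊆⇒length-≤ u (λ {y} y∈xs → ∈-∖⁺ (xs⊆ys (there y∈xs)) (λ y≡x → All.lookup x∉xs y∈xs (sym y≡x)))))
    (∖-length-< (xs⊆ys (here refl)))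

  length-∖∖ : ∀ {xs} ys → Unique xs → Unique ys → ys ⊆ xs → length (xs ∖∖ ys) + length ys ≡ length xs
  length-∖∖ [] _ _ _ = +-identityʳ _
  length-∖∖ {xs} (y ∷ ys) uxs (y∉ys ∷ uys) ys⊆xs = begin
    length ((xs ∖ y) ∖∖ ys) + suc (length ys) ≡⟨ +-suc _ _ ⟩
    suc (length ((xs ∖ y) ∖∖ ys) + length ys) ≡⟨ cong suc (length-∖∖ ys (∖-unique uxs) uys ys⊆xs∖y) ⟩
    suc (length (xs ∖ y))                     ≡⟨ ↭-length (↭-∷-∖ uxs (ys⊆xs (here refl))) ⟨
    length xs                                 ∎
    where
    open ≡-Reasoning
    ys⊆xs∖y : ys ⊆ xs ∖ y
    ys⊆xs∖y z∈ys = ∈-∖⁺ (ys⊆xs (there z∈ys)) (λ z≡y → All.lookup y∉ys z∈ys (sym z≡y))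

  sum-map-∖ : ∀ (f : A → ℕ) {x xs} → Unique xs → x ∈ xs → sum (map f xs) ≡ f x + sum (map f (xs ∖ x))
  sum-map-∖ f u x∈xs = sum-↭ (Perm.map⁺ f (↭-∷-∖ u x∈xs))

  length-filter-∖ : ∀ {p} {P : Pred A p} (P? : Decidable P) {x xs} → Unique xs → x ∈ xs →
    length (filter P? xs) ≡ length (filter P? [ x ]) + length (filter P? (xs ∖ x))
  length-filter-∖ P? {x} {xs} u x∈xs = trans (↭-length (filter-↭ P? (↭-∷-∖ u x∈xs)))
    (trans (cong length (filter-++ P? [ x ] (xs ∖ x))) (length-++ (filter P? [ x ])))

  unique-⊆-length-≤⇒⊇ : ∀ {ws ys} → Unique ws → ws ⊆ ys → length ys ≤ length ws → ys ⊆ ws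
  unique-⊆-length-≤⇒⊇ {ws} uw ws⊆ys ys≤ws {y} y∈ys with y ∈? ws
  ... | yes y∈ws = y∈ws
  ... | no y∉ws = contradiction ys≤ws (<⇒≱ (unique-⊆⇒length-≤ {y ∷ ws}
        (All.tabulate (λ w∈ws y≡w → y∉ws (subst (_∈ ws) (sym y≡w) w∈ws)) ∷ uw)
        (λ { (here refl) → y∈ys ; (there w∈ws) → ws⊆ys w∈ws })))

module _ {a p} {A : Set a} (_≟_ : DecidableEquality A) {P : Pred (A × A) p} (P? : Decidable P) where

  private
    length-filter-swap-≤ : ∀ {q} {Q : Pred (A × A) q} (Q? : Decidable Q) {xs} → Unique xs →
      length (filter (Q? ∘ swap) (cartesianProduct xs xs)) ≤ length (filter Q? (cartesianProduct xs xs))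
    length-filter-swap-≤ Q? {xs} u = subst (_≤ length (filter Q? (cartesianProduct xs xs)))
      (length-map swap (filter (Q? ∘ swap) (cartesianProduct xs xs)))
      (unique-⊆⇒length-≤ (Unique.map⁺ swap-injective (Unique.filter⁺ (Q? ∘ swap) (Unique.cartesianProduct⁺ u u))) swapped)
      where
      open DecidableListSets (≡-dec _≟_ _≟_)
      swap-injective : ∀ {p q : A × A} → swap p ≡ swap q → p ≡ q
      swap-injective refl = refl
      swapped : map swap (filter (Q? ∘ swap) (cartesianProduct xs xs)) ⊆ filter Q? (cartesianProduct xs xs)
      swapped q∈ with ∈-map⁻ swap q∈
      ... | (x , y) , p∈ , refl with ∈-filter⁻ (Q? ∘ swap) {xs = cartesianProduct xs xs} p∈
      ...   | xy∈ , qyx with ∈-cartesianProduct⁻ xs xs xy∈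
      ...     | x∈ , y∈ = ∈-filter⁺ Q? (∈-cartesianProduct⁺ y∈ x∈) qyx

  length-filter-swap : ∀ {xs} → Unique xs →
    length (filter (P? ∘ swap) (cartesianProduct xs xs)) ≡ length (filter P? (cartesianProduct xs xs))
  length-filter-swap u = ≤-antisym (length-filter-swap-≤ P? u) (length-filter-swap-≤ (P? ∘ swap) u)

length-filter-greater : ∀ {n} (x : Fin n) → length (filter (x <?_) (allFin n)) ≡ n ∸ suc (toℕ x)
length-filter-greater {suc n} Fin.zero = begin
  length (filter (Fin.zero {n} <?_) (tabulate (Fin.suc {n})))
    ≡⟨ cong (length ∘ filter (Fin.zero {n} <?_)) (sym (map-tabulate {n = n} id Fin.suc)) ⟩
  length (filter (Fin.zero {n} <?_) (map (Fin.suc {n}) (allFin n)))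
    ≡⟨ length-filter-map (Fin.zero {n} <?_) Fin.suc (allFin n) ⟩
  length (filter (λ y → Fin.zero {n} <? Fin.suc y) (allFin n))
    ≡⟨ cong length (filter-all (λ y → Fin.zero {n} <? Fin.suc y) {xs = allFin n} (All.tabulate (λ _ → s≤s z≤n))) ⟩
  length (allFin n)
    ≡⟨ length-tabulate id ⟩
  n ∎
  where open ≡-Reasoning
length-filter-greater {suc n} (Fin.suc x) = begin
  length (filter (Fin.suc x <?_) (tabulate (Fin.suc {n})))
    ≡⟨ cong (length ∘ filter (Fin.suc x <?_)) (sym (map-tabulate {n = n} id Fin.suc)) ⟩
  length (filter (Fin.suc x <?_) (map (Fin.suc {n}) (allFin n)))
    ≡⟨ length-filter-map (Fin.suc x <?_) Fin.suc (allFin n) ⟩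
  length (filter (λ y → Fin.suc x <? Fin.suc y) (allFin n))
    ≡⟨ length-filter-≐ (λ y → Fin.suc x <? Fin.suc y) (x <?_) (s≤s⁻¹ , s≤s) (allFin n) ⟩
  length (filter (x <?_) (allFin n))
    ≡⟨ length-filter-greater x ⟩
  n ∸ suc (toℕ x) ∎
  where open ≡-Reasoning

sum-greater≡C2 : ∀ n → sum (map (λ x → n ∸ suc (toℕ x)) (allFin n)) ≡ n C 2
sum-greater≡C2 zero = refl
sum-greater≡C2 (suc n) = begin
  n + sum (map (λ x → suc n ∸ suc (toℕ x)) (tabulate (Fin.suc {n})))
    ≡⟨ cong (λ xs → n + sum xs) (trans (map-tabulate (Fin.suc {n}) _) (sym (map-tabulate {n = n} id _))) ⟩
  n + sum (map (λ x → n ∸ suc (toℕ x)) (allFin n))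
    ≡⟨ cong₂ _+_ (sym (nC1≡n n)) (sum-greater≡C2 n) ⟩
  n C 1 + n C 2
    ≡⟨ nCk+nC[k+1]≡[n+1]C[k+1] n 1 ⟩
  suc n C 2 ∎
  where open ≡-Reasoning

length-increasingPairs : ∀ n → length (filter (λ p → proj₁ p <? proj₂ p) (cartesianProduct (allFin n) (allFin n))) ≡ n C 2
length-increasingPairs n = begin
  length (filter (λ p → proj₁ p <? proj₂ p) (cartesianProduct (allFin n) (allFin n)))
    ≡⟨ length-filter-cartesianProduct (λ p → proj₁ p <? proj₂ p) (allFin n) (allFin n) ⟩
  sum (map (λ x → length (filter (x <?_) (allFin n))) (allFin n))
    ≡⟨ cong sum (map-cong length-filter-greater (allFin n)) ⟩
  sum (map (λ x → n ∸ suc (toℕ x)) (allFin n))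
    ≡⟨ sum-greater≡C2 n ⟩
  n C 2 ∎
  where open ≡-Reasoning

module _ {a} {A : Set a} {x : A} where

  index-<-length⇒∈ : ∀ xs {ys} (p : x ∈ xs ++ ys) → toℕ (Any.index p) < length xs → x ∈ xs
  index-<-length⇒∈ (y ∷ xs) (here x≡y) _ = here x≡y
  index-<-length⇒∈ (y ∷ xs) (there p) (s≤s i<|xs|) = there (index-<-length⇒∈ xs p i<|xs|)

  toℕ-index-++⁺ˡ : ∀ {xs ys} (p : x ∈ xs) → toℕ (Any.index (∈-++⁺ˡ {ys = ys} p)) ≡ toℕ (Any.index p)
  toℕ-index-++⁺ˡ (here _) = refl
  toℕ-index-++⁺ˡ (there p) = cong suc (toℕ-index-++⁺ˡ p)

  index-<-length⇔∈ : ∀ {L} xs ys → L ≡ xs ++ ys → Unique L → (p : x ∈ L) → (toℕ (Any.index p) < length xs) ⇔ (x ∈ xs)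
  index-<-length⇔∈ xs ys refl uL p = mk⇔ (index-<-length⇒∈ xs p) λ x∈xs →
    subst (λ q → toℕ (Any.index q) < length xs) (unique⇒irrelevant uL (∈-++⁺ˡ x∈xs) p)
      (subst (_< length xs) (sym (toℕ-index-++⁺ˡ x∈xs)) (toℕ<n (Any.index x∈xs)))

index-∈-lookup : ∀ {a} {A : Set a} (xs : List A) i → Any.index (∈-lookup {xs = xs} i) ≡ i
index-∈-lookup (x ∷ xs) Fin.zero = refl
index-∈-lookup (x ∷ xs) (Fin.suc i) = cong Fin.suc (index-∈-lookup xs i)

module Listing {n} {L : List (Fin n)} (uL : Unique L) (cover : ∀ x → x ∈ L) where

  open DecidableListSets (Fin._≟_ {n})

  length≡n : length L ≡ n
  length≡n = ≤-antisym (subst (length L ≤_) (length-tabulate id) (unique-⊆⇒length-≤ uL (λ {x} _ → ∈-allFin x)))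
                       (subst (_≤ length L) (length-tabulate id) (unique-⊆⇒length-≤ (Unique.allFin⁺ n) (λ {x} _ → cover x)))

  position : Fin n ↔ Fin n
  position = mk↔ₛ′ to from to∘from from∘to
    where
    to : Fin n → Fin n
    to x = Fin.cast length≡n (Any.index (cover x))
    from : Fin n → Fin n
    from i = lookup L (Fin.cast (sym length≡n) i)
    to∘from : ∀ i → to (from i) ≡ i
    to∘from i = begin
      Fin.cast length≡n (Any.index (cover (lookup L j)))
        ≡⟨ cong (Fin.cast length≡n ∘ Any.index) (unique⇒irrelevant uL (cover _) (∈-lookup j)) ⟩
      Fin.cast length≡n (Any.index (∈-lookup {xs = L} j))
        ≡⟨ cong (Fin.cast length≡n) (index-∈-lookup L j) ⟩
      Fin.cast length≡n j
        ≡⟨ cast-involutive length≡n (sym length≡n) i ⟩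
      i ∎
      where
      open ≡-Reasoning
      j = Fin.cast (sym length≡n) i
    from∘to : ∀ x → from (to x) ≡ x
    from∘to x = trans (cong (lookup L) (cast-involutive (sym length≡n) length≡n (Any.index (cover x))))
                      (sym (lookup-index (cover x)))

  toℕ-position : ∀ x → toℕ (Inverse.to position x) ≡ toℕ (Any.index (cover x))
  toℕ-position x = toℕ-cast length≡n (Any.index (cover x))

  position-<⇔∈ : ∀ xs ys → L ≡ xs ++ ys → ∀ x → (toℕ (Inverse.to position x) < length xs) ⇔ (x ∈ xs)
  position-<⇔∈ xs ys L≡ x = subst (λ t → (t < length xs) ⇔ (x ∈ xs)) (sym (toℕ-position x))
    (index-<-length⇔∈ xs ys L≡ uL (cover x))

module CoDegree {n : ℕ} (G : Graph n) where

  open DecidableListSets (Fin._≟_ {n}) public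

  Vertex : Set
  Vertex = Fin n

  adjacent⇒≢ : ∀ {x y} → adj G x y ≡ true → x ≢ y
  adjacent⇒≢ {x} x~y refl with trans (sym x~y) (irrefl G x)
  ... | ()

  NonNeighbour : Vertex → Vertex → Set
  NonNeighbour x y = y ≢ x × adj G x y ≡ false

  nonNeighbour? : ∀ x → Decidable (NonNeighbour x)
  nonNeighbour? x y = ¬? (y Fin.≟ x) ×-dec (adj G x y Bool.≟ false)

  NonNeighbour-sym : ∀ {x y} → NonNeighbour x y → NonNeighbour y x
  NonNeighbour-sym {x} {y} (y≢x , x≁y) = (λ x≡y → y≢x (sym x≡y)) , trans (symm G y x) x≁y

  ¬NonNeighbour⇒adjacent : ∀ {x y} → x ≢ y → ¬ NonNeighbour x y → adj G x y ≡ true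
  ¬NonNeighbour⇒adjacent {x} {y} x≢y ¬x≁y with adj G x y
  ... | true = refl
  ... | false = contradiction (x≢y ∘ sym , refl) ¬x≁y

  nonNeighbours : Vertex → List Vertex → List Vertex
  nonNeighbours x R = filter (nonNeighbour? x) R

  coDegree : Vertex → List Vertex → ℕ
  coDegree x R = length (nonNeighbours x R)

  -- twice the number of edges of the complement of the induced subgraph G[R]
  coDegreeSum : List Vertex → ℕ
  coDegreeSum R = sum (map (λ x → coDegree x R) R)

  ∈-nonNeighbours⁻ : ∀ {x y R} → y ∈ nonNeighbours x R → y ∈ R × NonNeighbour x y
  ∈-nonNeighbours⁻ {x} {R = R} = ∈-filter⁻ (nonNeighbour? x) {xs = R}

  ∈-nonNeighbours⁺ : ∀ {x y R} → y ∈ R → NonNeighbour x y → y ∈ nonNeighbours x R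
  ∈-nonNeighbours⁺ {x} = ∈-filter⁺ (nonNeighbour? x)

  nonNeighbours-unique : ∀ {x R} → Unique R → Unique (nonNeighbours x R)
  nonNeighbours-unique {x} = Unique.filter⁺ (nonNeighbour? x)

  ⊆-nonNeighbours⇒length-≤ : ∀ {x ws R} → Unique ws → (∀ {w} → w ∈ ws → w ∈ R × NonNeighbour x w) →
    length ws ≤ coDegree x R
  ⊆-nonNeighbours⇒length-≤ uws ws⊆ =
    unique-⊆⇒length-≤ uws (λ w∈ws → let w∈R , x≁w = ws⊆ w∈ws in ∈-nonNeighbours⁺ w∈R x≁w)

  coDegree-≤⇒nonNeighbours⊆ : ∀ {x ws R} → Unique ws → (∀ {w} → w ∈ ws → w ∈ R × NonNeighbour x w) →
    coDegree x R ≤ length ws → ∀ {y} → y ∈ R → NonNeighbour x y → y ∈ ws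
  coDegree-≤⇒nonNeighbours⊆ uws ws⊆ ≤ws y∈R x≁y = unique-⊆-length-≤⇒⊇ uws
    (λ w∈ws → let w∈R , x≁w = ws⊆ w∈ws in ∈-nonNeighbours⁺ w∈R x≁w) ≤ws (∈-nonNeighbours⁺ y∈R x≁y)

  private
    singleton-sym : ∀ x y → length (nonNeighbours x [ y ]) ≡ length (nonNeighbours y [ x ])
    singleton-sym x y = length-filter-singleton-cong (nonNeighbour? x) (nonNeighbour? y) NonNeighbour-sym NonNeighbour-sym

    singleton-self : ∀ x → length (nonNeighbours x [ x ]) ≡ 0
    singleton-self x = cong length (filter-reject (nonNeighbour? x) {xs = []} (λ (x≢x , _) → x≢x refl))

  coDegree-∖ : ∀ {x u R} → Unique R → u ∈ R → coDegree x R ≡ length (nonNeighbours x [ u ]) + coDegree x (R ∖ u)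
  coDegree-∖ {x} = length-filter-∖ (nonNeighbour? x)

  -- Deleting u removes the row of u and, non-adjacency being symmetric, as much again from the other rows.
  coDegreeSum-∖ : ∀ {u R} → Unique R → u ∈ R → coDegreeSum R ≡ 2 * coDegree u R + coDegreeSum (R ∖ u)
  coDegreeSum-∖ {u} {R} uR u∈R = begin
    coDegreeSum R
      ≡⟨ sum-map-∖ (λ x → coDegree x R) uR u∈R ⟩
    coDegree u R + sum (map (λ x → coDegree x R) R′)
      ≡⟨ cong (λ xs → coDegree u R + sum xs) (map-cong (λ x → coDegree-∖ {x} uR u∈R) R′) ⟩
    coDegree u R + sum (map (λ x → length (nonNeighbours x [ u ]) + coDegree x R′) R′)
      ≡⟨ cong (coDegree u R +_) (sum-map-+ (λ x → length (nonNeighbours x [ u ])) (λ x → coDegree x R′) R′) ⟩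
    coDegree u R + (sum (map (λ x → length (nonNeighbours x [ u ])) R′) + coDegreeSum R′)
      ≡⟨ cong (λ t → coDegree u R + (t + coDegreeSum R′)) u-column ⟩
    coDegree u R + (coDegree u R + coDegreeSum R′)
      ≡⟨ sym (+-assoc (coDegree u R) _ _) ⟩
    coDegree u R + coDegree u R + coDegreeSum R′
      ≡⟨ cong (_+ coDegreeSum R′) (cong (coDegree u R +_) (sym (+-identityʳ (coDegree u R)))) ⟩
    2 * coDegree u R + coDegreeSum R′ ∎
    where
    open ≡-Reasoning
    R′ = R ∖ u
    u-column : sum (map (λ x → length (nonNeighbours x [ u ])) R′) ≡ coDegree u R
    u-column = begin
      sum (map (λ x → length (nonNeighbours x [ u ])) R′) ≡⟨ cong sum (map-cong (λ x → singleton-sym x u) R′) ⟩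
      sum (map (λ x → length (nonNeighbours u [ x ])) R′) ≡⟨ sym (length-filter≡sum-singletons (nonNeighbour? u) R′) ⟩
      coDegree u R′                                      ≡⟨ cong (_+ coDegree u R′) (singleton-self u) ⟨
      length (nonNeighbours u [ u ]) + coDegree u R′     ≡⟨ coDegree-∖ uR u∈R ⟨
      coDegree u R                                       ∎

  length-∖ : ∀ {u R} → Unique R → u ∈ R → length R ≡ suc (length (R ∖ u))
  length-∖ uR u∈R = ↭-length (↭-∷-∖ uR u∈R)

  coDegreeSum-∖-≤ : ∀ {u R} → Unique R → coDegreeSum (R ∖ u) ≤ coDegreeSum R
  coDegreeSum-∖-≤ {u} {R} uR with u ∈? R
  ... | yes u∈R = subst (coDegreeSum (R ∖ u) ≤_) (sym (coDegreeSum-∖ uR u∈R)) (m≤n+m _ _)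
  ... | no u∉R = ≤-reflexive (cong coDegreeSum (∖-∉ u∉R))

  2*coDegree≤coDegreeSum : ∀ {u R} → Unique R → u ∈ R → 2 * coDegree u R ≤ coDegreeSum R
  2*coDegree≤coDegreeSum {u} {R} uR u∈R = subst (2 * coDegree u R ≤_) (sym (coDegreeSum-∖ uR u∈R)) (m≤m+n _ _)

  coDegree-∖-neighbour : ∀ {u v R} → Unique R → u ∈ R → adj G u v ≡ true → coDegree v (R ∖ u) ≡ coDegree v R
  coDegree-∖-neighbour {u} {v} {R} uR u∈R u~v = sym (trans (coDegree-∖ uR u∈R)
    (cong (_+ coDegree v (R ∖ u)) (cong length (filter-reject (nonNeighbour? v) {xs = []} u-not-nonNeighbour))))
    where
    u-not-nonNeighbour : ¬ NonNeighbour v u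
    u-not-nonNeighbour (_ , v≁u) with trans (sym u~v) (trans (symm G u v) v≁u)
    ... | ()

  coDegreeSum-∖-adjacent : ∀ {u v R} → Unique R → u ∈ R → v ∈ R → adj G u v ≡ true →
    coDegreeSum R ≡ 2 * (coDegree u R + coDegree v R) + coDegreeSum (R ∖ u ∖ v)
  coDegreeSum-∖-adjacent {u} {v} {R} uR u∈R v∈R u~v = begin
    coDegreeSum R
      ≡⟨ coDegreeSum-∖ uR u∈R ⟩
    2 * coDegree u R + coDegreeSum (R ∖ u)
      ≡⟨ cong (2 * coDegree u R +_) (coDegreeSum-∖ (∖-unique uR) (∈-∖⁺ v∈R (adjacent⇒≢ u~v ∘ sym))) ⟩
    2 * coDegree u R + (2 * coDegree v (R ∖ u) + coDegreeSum (R ∖ u ∖ v))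
      ≡⟨ cong (λ t → 2 * coDegree u R + (2 * t + coDegreeSum (R ∖ u ∖ v))) (coDegree-∖-neighbour uR u∈R u~v) ⟩
    2 * coDegree u R + (2 * coDegree v R + coDegreeSum (R ∖ u ∖ v))
      ≡⟨ sym (+-assoc (2 * coDegree u R) _ _) ⟩
    2 * coDegree u R + 2 * coDegree v R + coDegreeSum (R ∖ u ∖ v)
      ≡⟨ cong (_+ coDegreeSum (R ∖ u ∖ v)) (sym (*-distribˡ-+ 2 (coDegree u R) _)) ⟩
    2 * (coDegree u R + coDegree v R) + coDegreeSum (R ∖ u ∖ v) ∎
    where open ≡-Reasoning

  nonNeighbour⇒1≤coDegree : ∀ {x y R} → y ∈ R → NonNeighbour x y → 1 ≤ coDegree x R
  nonNeighbour⇒1≤coDegree y∈R x≁y = ∈-length (∈-nonNeighbours⁺ y∈R x≁y)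

  1≤coDegree⇒nonNeighbour : ∀ {x} R → 1 ≤ coDegree x R → ∃ λ y → y ∈ R × NonNeighbour x y
  1≤coDegree⇒nonNeighbour {x} R 1≤ with nonNeighbours x R in eq
  ... | y ∷ _ = y , ∈-nonNeighbours⁻ (subst (y ∈_) (sym eq) (here refl))

  Complete : List Vertex → Set
  Complete R = ∀ {x y} → x ∈ R → y ∈ R → ¬ NonNeighbour x y

  coDegreeSum-Complete : ∀ {R} → Complete R → coDegreeSum R ≡ 0
  coDegreeSum-Complete {R} complete = sum-map-≡0 (λ x → coDegree x R) R
    (λ x∈R → cong length (filter-none (nonNeighbour? _) (All.tabulate (complete x∈R))))

  coDegreeSum≡0⇒Complete : ∀ {R} → coDegreeSum R ≡ 0 → Complete R
  coDegreeSum≡0⇒Complete {R} δ≡0 {x} x∈R y∈R x≁y = contradiction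
    (≤-trans (nonNeighbour⇒1≤coDegree y∈R x≁y) (subst (coDegree x R ≤_) δ≡0 (≤-sum-map (λ x → coDegree x R) x∈R))) λ ()

  Isolated : List Vertex → Vertex → Set
  Isolated R u = ∀ {w} → w ∈ R → w ≢ u → adj G u w ≡ false

  neighbourOrIsolated : ∀ u R → (∃ λ v → v ∈ R × adj G u v ≡ true) ⊎ Isolated R u
  neighbourOrIsolated u R with search (λ v → adj G u v Bool.≟ true) R
  ... | inj₁ found = inj₁ found
  ... | inj₂ none = inj₂ (λ w∈R _ → ¬-not (none w∈R))

  isolated⇒length-≤ : ∀ {u R} → Unique R → u ∈ R → Isolated R u → length R ≤ suc (coDegree u R)
  isolated⇒length-≤ {u} {R} uR u∈R isolated = subst (_≤ suc (coDegree u R)) (sym (length-∖ uR u∈R))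
    (s≤s (⊆-nonNeighbours⇒length-≤ (∖-unique uR)
      (λ w∈R∖u → let w∈R , w≢u = ∈-∖⁻ R w∈R∖u in w∈R , w≢u , isolated w∈R w≢u)))

  record IndependentTriple : Set where
    field
      x y z : Vertex
      x≁y   : NonNeighbour x y
      x≁z   : NonNeighbour x z
      y≁z   : NonNeighbour y z

  independentTriple? : Dec IndependentTriple
  independentTriple? with search (λ (x , y , z) → nonNeighbour? x y ×-dec nonNeighbour? x z ×-dec nonNeighbour? y z) triples
    where triples = cartesianProduct (allFin n) (cartesianProduct (allFin n) (allFin n))
  ... | inj₁ ((x , y , z) , _ , x≁y , x≁z , y≁z) = yes (record { x≁y = x≁y ; x≁z = x≁z ; y≁z = y≁z })
  ... | inj₂ none = no λ t → let open IndependentTriple t in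
    none (∈-cartesianProduct⁺ (∈-allFin x) (∈-cartesianProduct⁺ (∈-allFin y) (∈-allFin z))) (x≁y , x≁z , y≁z)

  coDegreeSum-∖∖-≤ : ∀ {R} ys → Unique R → coDegreeSum (R ∖∖ ys) ≤ coDegreeSum R
  coDegreeSum-∖∖-≤ [] _ = ≤-refl
  coDegreeSum-∖∖-≤ (y ∷ ys) uR = ≤-trans (coDegreeSum-∖∖-≤ ys (∖-unique uR)) (coDegreeSum-∖-≤ uR)

  coDegree-mono : ∀ {x R S} → Unique R → R ⊆ S → coDegree x R ≤ coDegree x S
  coDegree-mono uR R⊆S = ⊆-nonNeighbours⇒length-≤ (nonNeighbours-unique uR)
    (λ y∈ → let y∈R , x≁y = ∈-nonNeighbours⁻ y∈ in R⊆S y∈R , x≁y)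

  private
    vertexPairs : List (Vertex × Vertex)
    vertexPairs = cartesianProduct (allFin n) (allFin n)

    nonEdge? : Decidable (λ (p : Vertex × Vertex) → NonNeighbour (proj₁ p) (proj₂ p))
    nonEdge? (x , y) = nonNeighbour? x y

    increasing? : Decidable (λ (p : Vertex × Vertex) → proj₁ p Fin.< proj₂ p)
    increasing? (x , y) = x <? y

    increasingNonEdges : ℕ
    increasingNonEdges = length (filter (λ p → nonEdge? p ×-dec increasing? p) vertexPairs)

    coDegreeSum≡2*increasingNonEdges : coDegreeSum (allFin n) ≡ 2 * increasingNonEdges
    coDegreeSum≡2*increasingNonEdges = begin
      coDegreeSum (allFin n)
        ≡⟨ length-filter-cartesianProduct nonEdge? (allFin n) (allFin n) ⟨
      length (filter nonEdge? vertexPairs)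
        ≡⟨ length-filter-split nonEdge? increasing? vertexPairs ⟩
      increasingNonEdges + length (filter (λ p → nonEdge? p ×-dec ¬? (increasing? p)) vertexPairs)
        ≡⟨ cong (increasingNonEdges +_) (length-filter-≐ _ ((λ p → nonEdge? p ×-dec increasing? p) ∘ swap) decreasing≐ vertexPairs) ⟩
      increasingNonEdges + length (filter ((λ p → nonEdge? p ×-dec increasing? p) ∘ swap) vertexPairs)
        ≡⟨ cong (increasingNonEdges +_) (length-filter-swap Fin._≟_ (λ p → nonEdge? p ×-dec increasing? p) (Unique.allFin⁺ n)) ⟩
      increasingNonEdges + increasingNonEdges
        ≡⟨ cong (increasingNonEdges +_) (+-identityʳ increasingNonEdges) ⟨
      2 * increasingNonEdges ∎
      where
      open ≡-Reasoning
      decreasing≐ : (λ (p : Vertex × Vertex) → NonNeighbour (proj₁ p) (proj₂ p) × ¬ proj₁ p Fin.< proj₂ p)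
                  ≐ (λ p → NonNeighbour (proj₂ p) (proj₁ p) × proj₂ p Fin.< proj₁ p)
      decreasing≐ = (λ (x≁y , x≮y) → NonNeighbour-sym x≁y , ≤∧≢⇒< (≮⇒≥ x≮y) (proj₁ x≁y ∘ toℕ-injective))
                  , (λ (y≁x , y<x) → NonNeighbour-sym y≁x , <-asym y<x)

    increasingNonEdges+numEdges≡C2 : increasingNonEdges + numEdges G ≡ n C 2
    increasingNonEdges+numEdges≡C2 = begin
      increasingNonEdges + numEdges G
        ≡⟨ +-comm increasingNonEdges (numEdges G) ⟩
      numEdges G + increasingNonEdges
        ≡⟨ cong₂ _+_ (length-filter-≐ _ (λ p → increasing? p ×-dec (adj G (proj₁ p) (proj₂ p) Bool.≟ true)) edge≐ vertexPairs)
                     (length-filter-≐ _ (λ p → increasing? p ×-dec ¬? (adj G (proj₁ p) (proj₂ p) Bool.≟ true)) nonEdge≐ vertexPairs) ⟩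
      length (filter (λ p → increasing? p ×-dec (adj G (proj₁ p) (proj₂ p) Bool.≟ true)) vertexPairs)
        + length (filter (λ p → increasing? p ×-dec ¬? (adj G (proj₁ p) (proj₂ p) Bool.≟ true)) vertexPairs)
        ≡⟨ length-filter-split increasing? (λ p → adj G (proj₁ p) (proj₂ p) Bool.≟ true) vertexPairs ⟨
      length (filter increasing? vertexPairs)
        ≡⟨ length-increasingPairs n ⟩
      n C 2 ∎
      where
      open ≡-Reasoning
      edge≐ : (λ (p : Vertex × Vertex) → (⌊ proj₁ p <? proj₂ p ⌋ Bool.∧ adj G (proj₁ p) (proj₂ p)) ≡ true)
            ≐ (λ p → proj₁ p Fin.< proj₂ p × adj G (proj₁ p) (proj₂ p) ≡ true)
      edge≐ = (λ {p} → ⌊⌋∧≡true (proj₁ p <? proj₂ p)) , (λ {p} (x<y , x~y) → ≡true-⌊⌋∧ (proj₁ p <? proj₂ p) x<y x~y)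
      nonEdge≐ : (λ (p : Vertex × Vertex) → NonNeighbour (proj₁ p) (proj₂ p) × proj₁ p Fin.< proj₂ p)
               ≐ (λ p → proj₁ p Fin.< proj₂ p × adj G (proj₁ p) (proj₂ p) ≢ true)
      nonEdge≐ = (λ ((_ , x≁y) , x<y) → x<y , λ x~y → contradiction (trans (sym x~y) x≁y) λ ())
               , (λ (x<y , x≁y) → ((λ y≡x → <-irrefl (cong toℕ (sym y≡x)) x<y) , ¬-not x≁y) , x<y)

  coDegreeSum-allFin : coDegreeSum (allFin n) + 2 * numEdges G ≡ 2 * (n C 2)
  coDegreeSum-allFin = begin
    coDegreeSum (allFin n) + 2 * numEdges G      ≡⟨ cong (_+ 2 * numEdges G) coDegreeSum≡2*increasingNonEdges ⟩
    2 * increasingNonEdges + 2 * numEdges G      ≡⟨ *-distribˡ-+ 2 increasingNonEdges (numEdges G) ⟨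
    2 * (increasingNonEdges + numEdges G)        ≡⟨ cong (2 *_) increasingNonEdges+numEdges≡C2 ⟩
    2 * (n C 2)                                  ∎
    where open ≡-Reasoning

module PerfectMatchings {n : ℕ} (G : Graph n) where

  open CoDegree G

  record PerfectMatchingOn (R : List Vertex) : Set where
    field
      matching   : List (Vertex × Vertex)
      isMatching : IsMatching G matching
      covered⊆R  : endpoints matching ⊆ R
      R⊆covered  : R ⊆ endpoints matching

  perfectMatchingOn-[] : ∀ {R} → length R ≡ 0 → PerfectMatchingOn R
  perfectMatchingOn-[] {[]} _ = record { matching = [] ; isMatching = [] , [] ; covered⊆R = λ () ; R⊆covered = λ () }

  ∷-perfectMatchingOn : ∀ {u v R} → u ∈ R → v ∈ R → adj G u v ≡ true → PerfectMatchingOn (R ∖ u ∖ v) → PerfectMatchingOn R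
  ∷-perfectMatchingOn {u} {v} {R} u∈R v∈R u~v pm = record
    { matching   = (u , v) ∷ matching
    ; isMatching = (u~v ∷ proj₁ isMatching)
                 , (adjacent⇒≢ u~v ∷ All.tabulate (λ w∈ u≡w → ≢u w∈ (sym u≡w)))
                 ∷ All.tabulate (λ w∈ v≡w → ≢v w∈ (sym v≡w))
                 ∷ proj₂ isMatching
    ; covered⊆R  = λ { (here refl) → u∈R ; (there (here refl)) → v∈R ; (there (there w∈)) → ∖-⊆ (∖-⊆ (covered⊆R w∈)) }
    ; R⊆covered  = covers
    }
    where
    open PerfectMatchingOn pm
    ≢u : ∀ {w} → w ∈ endpoints matching → w ≢ u
    ≢u w∈ = proj₂ (∈-∖⁻ R (∖-⊆ (covered⊆R w∈)))
    ≢v : ∀ {w} → w ∈ endpoints matching → w ≢ v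
    ≢v w∈ = proj₂ (∈-∖⁻ (R ∖ u) (covered⊆R w∈))
    covers : R ⊆ u ∷ v ∷ endpoints matching
    covers {w} w∈R with w Fin.≟ u | w Fin.≟ v
    ... | yes w≡u | _ = here w≡u
    ... | no _ | yes w≡v = there (here w≡v)
    ... | no w≢u | no w≢v = there (there (R⊆covered (∈-∖⁺ (∈-∖⁺ w∈R w≢u) w≢v)))

  record ReducingEdge (R : List Vertex) : Set where
    field
      u v     : Vertex
      u∈R     : u ∈ R
      v∈R     : v ∈ R
      u~v     : adj G u v ≡ true
      reduces : 2 ≤ coDegree u R + coDegree v R ⊎ coDegreeSum (R ∖ u ∖ v) ≡ 0

  private
    isolated⇒2*length≤ : ∀ {u R} → Unique R → u ∈ R → Isolated R u → 2 * length R ≤ 2 + coDegreeSum R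
    isolated⇒2*length≤ {u} {R} uR u∈R isolated = begin
      2 * length R         ≤⟨ *-monoʳ-≤ 2 (isolated⇒length-≤ uR u∈R isolated) ⟩
      2 * suc (coDegree u R) ≡⟨ *-suc 2 (coDegree u R) ⟩
      2 + 2 * coDegree u R ≤⟨ +-monoʳ-≤ 2 (2*coDegree≤coDegreeSum uR u∈R) ⟩
      2 + coDegreeSum R    ∎
      where open ≤-Reasoning

    adjacent-unless-nonNeighbour : ∀ {x y z R} → coDegree x R ≤ 1 → y ∈ R → NonNeighbour x y →
      z ∈ R → z ≢ x → z ≢ y → adj G x z ≡ true
    adjacent-unless-nonNeighbour {x} {y} {z} ν≤1 y∈R x≁y z∈R z≢x z≢y with adj G x z in x≁z
    ... | true = refl
    ... | false with coDegree-≤⇒nonNeighbours⊆ ([] ∷ []) (λ { (here refl) → y∈R , x≁y }) ν≤1 z∈R (z≢x , x≁z)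
    ...   | here z≡y = contradiction z≡y z≢y

    reducingEdge-Complete : ∀ {R} → Unique R → 2 ≤ length R → Complete R → ReducingEdge R
    reducingEdge-Complete {x ∷ y ∷ R} ((x≢y ∷ _) ∷ _) _ complete = record
      { u = x ; v = y ; u∈R = here refl ; v∈R = there (here refl) ; u~v = x~y
      ; reduces = inj₂ (coDegreeSum-Complete (λ w∈ w′∈ → complete (∖-⊆ (∖-⊆ w∈)) (∖-⊆ (∖-⊆ w′∈)))) }
      where
      x~y : adj G x y ≡ true
      x~y with adj G x y in x≁y
      ... | true = refl
      ... | false = contradiction (x≢y ∘ sym , x≁y) (complete (here refl) (there (here refl)))
    reducingEdge-Complete {_ ∷ []} _ (s≤s ()) _

    reducingEdge-nonEdge : ∀ {R} → Unique R → coDegreeSum R + 4 ≤ 2 * length R →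
      (∀ {z} → z ∈ R → coDegree z R ≤ 1) → ∀ {x} → x ∈ R → 1 ≤ coDegree x R → ReducingEdge R
    reducingEdge-nonEdge {R} uR sparse ν≤1 {x} x∈R 1≤νx with 1≤coDegree⇒nonNeighbour R 1≤νx
    ... | y , y∈R , x≁y with search (λ z → (¬? (z Fin.≟ x) ×-dec ¬? (z Fin.≟ y)) ×-dec (1 ≤? coDegree z R)) R
    ...   | inj₁ (z , z∈R , (z≢x , z≢y) , 1≤νz) = record
            { u = x ; v = z ; u∈R = x∈R ; v∈R = z∈R ; u~v = adjacent-unless-nonNeighbour (ν≤1 x∈R) y∈R x≁y z∈R z≢x z≢y
            ; reduces = inj₁ (+-mono-≤ 1≤νx 1≤νz) }
    ...   | inj₂ no-third with search (λ z → ¬? (z Fin.≟ x) ×-dec ¬? (z Fin.≟ y)) R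
    ...     | inj₁ (z , z∈R , z≢x , z≢y) = record
              { u = x ; v = z ; u∈R = x∈R ; v∈R = z∈R ; u~v = adjacent-unless-nonNeighbour (ν≤1 x∈R) y∈R x≁y z∈R z≢x z≢y
              ; reduces = inj₂ (coDegreeSum-Complete complete) }
      where
      -- y, the only vertex besides x with a non-neighbour, has lost its unique non-neighbour x
      complete : Complete (R ∖ x ∖ z)
      complete {w} {w′} w∈ w′∈ w≁w′ with ∈-∖⁻ R (∖-⊆ w∈) | ∈-∖⁻ R (∖-⊆ w′∈) | w Fin.≟ y
      ... | w∈R , w≢x | w′∈R , _ | no w≢y = no-third w∈R ((w≢x , w≢y) , nonNeighbour⇒1≤coDegree w′∈R w≁w′)
      ... | _ | w′∈R , w′≢x | yes refl with coDegree-≤⇒nonNeighbours⊆ ([] ∷ []) (λ { (here refl) → x∈R , NonNeighbour-sym x≁y })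
                                              (ν≤1 y∈R) w′∈R w≁w′
      ...   | here w′≡x = w′≢x w′≡x
    ...     | inj₂ only-x-y = contradiction (≤-trans (+-monoˡ-≤ 4 2≤δ) (≤-trans sparse (*-monoʳ-≤ 2 |R|≤2)))
                                λ { (s≤s (s≤s (s≤s (s≤s ())))) }
      where
      2≤δ : 2 ≤ coDegreeSum R
      2≤δ = ≤-trans (*-monoʳ-≤ 2 1≤νx) (2*coDegree≤coDegreeSum uR x∈R)
      R⊆xy : R ⊆ x ∷ y ∷ []
      R⊆xy {z} z∈R with z Fin.≟ x | z Fin.≟ y
      ... | yes z≡x | _ = here z≡x
      ... | no _ | yes z≡y = there (here z≡y)
      ... | no z≢x | no z≢y = contradiction (z≢x , z≢y) (only-x-y z∈R)
      |R|≤2 : length R ≤ 2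
      |R|≤2 = unique-⊆⇒length-≤ uR R⊆xy

  reducingEdge : ∀ {R} → Unique R → coDegreeSum R + 4 ≤ 2 * length R → ReducingEdge R
  reducingEdge {R} uR sparse with search (λ u → 2 ≤? coDegree u R) R
  ... | inj₁ (u , u∈R , 2≤νu) with neighbourOrIsolated u R
  ...   | inj₁ (v , v∈R , u~v) = record
          { u = u ; v = v ; u∈R = u∈R ; v∈R = v∈R ; u~v = u~v ; reduces = inj₁ (≤-trans 2≤νu (m≤m+n _ _)) }
  ...   | inj₂ isolated = contradiction (≤-trans sparse (isolated⇒2*length≤ uR u∈R isolated)) (m+4≰2+m _)
  reducingEdge {R} uR sparse | inj₂ ν≤1 with search (λ x → 1 ≤? coDegree x R) R
  ... | inj₁ (x , x∈R , 1≤νx) = reducingEdge-nonEdge uR sparse (λ z∈R → s≤s⁻¹ (≰⇒> (ν≤1 z∈R))) x∈R 1≤νx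
  ... | inj₂ ν≡0 = reducingEdge-Complete uR 2≤|R| (λ x∈R y∈R x≁y → ν≡0 x∈R (nonNeighbour⇒1≤coDegree y∈R x≁y))
    where
    2≤|R| : 2 ≤ length R
    2≤|R| = *-cancelˡ-≤ 2 (≤-trans (m≤n+m 4 (coDegreeSum R)) sparse)

  length-∖-∖ : ∀ {u v R} → Unique R → u ∈ R → v ∈ R → adj G u v ≡ true → length R ≡ suc (suc (length (R ∖ u ∖ v)))
  length-∖-∖ uR u∈R v∈R u~v =
    trans (length-∖ uR u∈R) (cong suc (length-∖ (∖-unique uR) (∈-∖⁺ v∈R (adjacent⇒≢ u~v ∘ sym))))

  -- For |R| = 2(m + 1) the bounds below say that G[R] misses at most |R| - 2 edges, resp. G[R ∖ u ∖ v] at most |R| - 4.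
  perfectMatchingOn-sparse : ∀ m {R} → Unique R → length R ≡ 2 * suc m → coDegreeSum R ≤ 4 * m → PerfectMatchingOn R
  perfectMatchingOn-∖-edge : ∀ m {R u v} → Unique R → length R ≡ 2 * suc m → u ∈ R → v ∈ R → adj G u v ≡ true →
    coDegreeSum (R ∖ u ∖ v) ≤ 4 * (m ∸ 1) → PerfectMatchingOn R

  perfectMatchingOn-sparse m {R} uR |R|≡ δ≤ = matchAlong (reducingEdge uR sparse)
    where
    sparse : coDegreeSum R + 4 ≤ 2 * length R
    sparse = subst (coDegreeSum R + 4 ≤_) (sym (trans (cong (2 *_) |R|≡) (2*2*suc≡4*m+4 m))) (+-monoˡ-≤ 4 δ≤)
    matchAlong : ReducingEdge R → PerfectMatchingOn R
    matchAlong e = perfectMatchingOn-∖-edge m uR |R|≡ u∈R v∈R u~v (remainder-bound reduces)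
      where
      open ReducingEdge e
      remainder-bound : 2 ≤ coDegree u R + coDegree v R ⊎ coDegreeSum (R ∖ u ∖ v) ≡ 0 → coDegreeSum (R ∖ u ∖ v) ≤ 4 * (m ∸ 1)
      remainder-bound (inj₂ δ′≡0) = subst (_≤ 4 * (m ∸ 1)) (sym δ′≡0) z≤n
      remainder-bound (inj₁ 2≤νu+νv) = m+4≤4*n⇒m≤4*[n∸1] {n = m} (begin
        coDegreeSum (R ∖ u ∖ v) + 4                                   ≡⟨ +-comm (coDegreeSum (R ∖ u ∖ v)) 4 ⟩
        4 + coDegreeSum (R ∖ u ∖ v)                                   ≤⟨ +-monoˡ-≤ (coDegreeSum (R ∖ u ∖ v)) (*-monoʳ-≤ 2 2≤νu+νv) ⟩
        2 * (coDegree u R + coDegree v R) + coDegreeSum (R ∖ u ∖ v)   ≡⟨ coDegreeSum-∖-adjacent uR u∈R v∈R u~v ⟨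
        coDegreeSum R                                                 ≤⟨ δ≤ ⟩
        4 * m                                                         ∎)
        where open ≤-Reasoning

  perfectMatchingOn-∖-edge m {R} {u} {v} uR |R|≡ u∈R v∈R u~v δ′≤ = ∷-perfectMatchingOn u∈R v∈R u~v (matchRest m |R′|≡ δ′≤)
    where
    |R′|≡ : length (R ∖ u ∖ v) ≡ 2 * m
    |R′|≡ = suc-injective (suc-injective (trans (sym (length-∖-∖ uR u∈R v∈R u~v)) (trans |R|≡ (*-suc 2 m))))
    matchRest : ∀ m → length (R ∖ u ∖ v) ≡ 2 * m → coDegreeSum (R ∖ u ∖ v) ≤ 4 * (m ∸ 1) → PerfectMatchingOn (R ∖ u ∖ v)
    matchRest zero |R′|≡0 _ = perfectMatchingOn-[] |R′|≡0
    matchRest (suc m) |R′|≡ δ′≤ = perfectMatchingOn-sparse m (∖-unique (∖-unique uR)) |R′|≡ δ′≤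

  perfectMatchingOn-along-heavy-edge : ∀ m {R u v} → Unique R → length R ≡ 2 * suc m → coDegreeSum R + 2 ≤ 2 * length R →
    u ∈ R → v ∈ R → adj G u v ≡ true → 3 ≤ coDegree u R + coDegree v R → PerfectMatchingOn R
  perfectMatchingOn-along-heavy-edge m {R} {u} {v} uR |R|≡ δ+2≤ u∈R v∈R u~v 3≤νu+νv =
    perfectMatchingOn-∖-edge m uR |R|≡ u∈R v∈R u~v (m+4≤4*n⇒m≤4*[n∸1] {n = m} (+-cancelʳ-≤ 4 _ _ (begin
      coDegreeSum (R ∖ u ∖ v) + 4 + 4                                   ≡⟨ +-rearrange (coDegreeSum (R ∖ u ∖ v)) ⟩
      2 * 3 + coDegreeSum (R ∖ u ∖ v) + 2                               ≤⟨ +-monoˡ-≤ 2 (+-monoˡ-≤ _ (*-monoʳ-≤ 2 3≤νu+νv)) ⟩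
      2 * (coDegree u R + coDegree v R) + coDegreeSum (R ∖ u ∖ v) + 2   ≡⟨ cong (_+ 2) (coDegreeSum-∖-adjacent uR u∈R v∈R u~v) ⟨
      coDegreeSum R + 2                                                 ≤⟨ δ+2≤ ⟩
      2 * length R                                                      ≡⟨ cong (2 *_) |R|≡ ⟩
      2 * (2 * suc m)                                                   ≡⟨ 2*2*suc≡4*m+4 m ⟩
      4 * m + 4                                                         ∎)))
    where
    open ≤-Reasoning
    +-rearrange : ∀ d → d + 4 + 4 ≡ 2 * 3 + d + 2
    +-rearrange = solve-∀

  private
    two-distinct : ∀ {a} {A : Set a} {xs : List A} → Unique xs → 2 ≤ length xs → ∃ λ b → ∃ λ c → b ∈ xs × c ∈ xs × b ≢ c
    two-distinct {xs = b ∷ c ∷ _} ((b≢c ∷ _) ∷ _) _ = b , c , here refl , there (here refl) , b≢c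
    two-distinct {xs = _ ∷ []} _ (s≤s ())

    low-coDegree⇒isolated : ∀ m {R} → Unique R → length R ≡ 2 * suc m → 4 * m < coDegreeSum R →
      (∀ {x} → x ∈ R → coDegree x R ≤ 1) → ∃ λ u → u ∈ R × Isolated R u
    low-coDegree⇒isolated m {R} uR |R|≡ 4m<δ ν≤1 with search (λ x → 1 ≤? coDegree x R) R
    ... | inj₂ ν≡0 = contradiction (sum-map-≡0 (λ x → coDegree x R) R (λ x∈R → n<1⇒n≡0 (≰⇒> (ν≡0 x∈R))))
                       (>⇒≢ (≤-trans (s≤s z≤n) 4m<δ))
    ... | inj₁ (x , x∈R , 1≤νx) with 1≤coDegree⇒nonNeighbour R 1≤νx
    ...   | y , y∈R , x≢y , x≁y = x , x∈R , isolated
      where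
      |R|≡2 : length R ≡ 2
      |R|≡2 = trans |R|≡ (cong (λ m → 2 * suc m) (4*m<2*suc-m⇒m≡0 (≤-trans 4m<δ
        (subst (coDegreeSum R ≤_) (trans (*-identityʳ _) |R|≡) (sum-map-≤ (λ x → coDegree x R) R ν≤1)))))
      R⊆xy : R ⊆ x ∷ y ∷ []
      R⊆xy = unique-⊆-length-≤⇒⊇ ((x≢y ∘ sym ∷ []) ∷ [] ∷ []) (λ { (here refl) → x∈R ; (there (here refl)) → y∈R })
        (≤-reflexive |R|≡2)
      isolated : Isolated R x
      isolated w∈R w≢x with R⊆xy w∈R
      ... | here w≡x = contradiction w≡x w≢x
      ... | there (here refl) = x≁y

    -- Every missing edge of G[R] lies in {u, b, c}, since u misses only b, c and its neighbours miss nothing;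
    -- counting then forces |R| = 4 and b ≁ c.
    independentTriple : ∀ m {R u b c} → Unique R → length R ≡ 2 * suc m → 4 * m < coDegreeSum R →
      u ∈ R → coDegree u R ≤ 2 → b ∈ R → c ∈ R → NonNeighbour u b → NonNeighbour u c → b ≢ c →
      (∀ {v} → v ∈ R → adj G u v ≡ true → coDegree v R ≡ 0) → length R ≡ 4 × IndependentTriple
    independentTriple m {R} {u} {b} {c} uR |R|≡ 4m<δ u∈R νu≤2 b∈R c∈R u≁b u≁c b≢c nbrs-full = |R|≡4 , record
      { x = u ; y = b ; z = c ; x≁y = u≁b ; x≁z = u≁c ; y≁z = b≁c }
      where
      bc : List Vertex
      bc = b ∷ c ∷ []
      bc-unique : Unique bc
      bc-unique = (b≢c ∷ []) ∷ [] ∷ []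
      on-triangle : ∀ {x y} → x ∈ R → y ∈ R → NonNeighbour x y → x ≡ u ⊎ x ∈ bc
      on-triangle {x} {y} x∈R y∈R x≁y with x Fin.≟ u | adj G u x in u~x
      ... | yes x≡u | _ = inj₁ x≡u
      ... | no _ | true = contradiction (nbrs-full x∈R u~x) (>⇒≢ (nonNeighbour⇒1≤coDegree y∈R x≁y))
      ... | no x≢u | false = inj₂ (coDegree-≤⇒nonNeighbours⊆ bc-unique
              (λ { (here refl) → b∈R , u≁b ; (there (here refl)) → c∈R , u≁c }) νu≤2 x∈R (x≢u , u~x))
      R∖u∖b-complete : Complete (R ∖ u ∖ b)
      R∖u∖b-complete {x} {y} x∈ y∈ x≁y
          with ∈-∖⁻ (R ∖ u) x∈ | ∈-∖⁻ R (∖-⊆ {xs = R ∖ u} x∈) | ∈-∖⁻ (R ∖ u) y∈ | ∈-∖⁻ R (∖-⊆ {xs = R ∖ u} y∈)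
      ... | _ , x≢b | x∈R , x≢u | _ , y≢b | y∈R , y≢u
          with on-triangle x∈R y∈R x≁y | on-triangle y∈R x∈R (NonNeighbour-sym x≁y)
      ... | inj₁ x≡u | _ = x≢u x≡u
      ... | _ | inj₁ y≡u = y≢u y≡u
      ... | inj₂ (here x≡b) | _ = x≢b x≡b
      ... | _ | inj₂ (here y≡b) = y≢b y≡b
      ... | inj₂ (there (here refl)) | inj₂ (there (here refl)) = proj₁ x≁y refl
      b∈R∖u : b ∈ R ∖ u
      b∈R∖u = ∈-∖⁺ b∈R (proj₁ u≁b)
      nonNeighbours-of-b : ∀ {y} → y ∈ R ∖ u → NonNeighbour b y → y ≡ c
      nonNeighbours-of-b {y} y∈ b≁y with ∈-∖⁻ R y∈
      ... | y∈R , y≢u with on-triangle y∈R b∈R (NonNeighbour-sym b≁y)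
      ...   | inj₁ y≡u = contradiction y≡u y≢u
      ...   | inj₂ (here y≡b) = contradiction y≡b (proj₁ b≁y)
      ...   | inj₂ (there (here y≡c)) = y≡c
      νb≤1 : coDegree b (R ∖ u) ≤ 1
      νb≤1 = unique-⊆⇒length-≤ {ys = c ∷ []} (nonNeighbours-unique (∖-unique uR)) λ y∈ →
        let y∈R∖u , b≁y = ∈-nonNeighbours⁻ {R = R ∖ u} y∈ in here (nonNeighbours-of-b y∈R∖u b≁y)
      δ≤4+2νb : coDegreeSum R ≤ 4 + 2 * coDegree b (R ∖ u)
      δ≤4+2νb = begin
        coDegreeSum R
          ≡⟨ coDegreeSum-∖ uR u∈R ⟩
        2 * coDegree u R + coDegreeSum (R ∖ u)
          ≡⟨ cong (2 * coDegree u R +_) (coDegreeSum-∖ (∖-unique uR) b∈R∖u) ⟩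
        2 * coDegree u R + (2 * coDegree b (R ∖ u) + coDegreeSum (R ∖ u ∖ b))
          ≡⟨ cong (λ t → 2 * coDegree u R + (2 * coDegree b (R ∖ u) + t)) (coDegreeSum-Complete R∖u∖b-complete) ⟩
        2 * coDegree u R + (2 * coDegree b (R ∖ u) + 0)
          ≤⟨ +-mono-≤ (*-monoʳ-≤ 2 νu≤2) (≤-reflexive (+-identityʳ _)) ⟩
        4 + 2 * coDegree b (R ∖ u) ∎
        where open ≤-Reasoning
      3≤|R| : 3 ≤ length R
      3≤|R| = unique-⊆⇒length-≤ ((proj₁ u≁b ∘ sym ∷ proj₁ u≁c ∘ sym ∷ []) ∷ bc-unique)
        (λ { (here refl) → u∈R ; (there (here refl)) → b∈R ; (there (there (here refl))) → c∈R })
      1≤m : 1 ≤ m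
      1≤m = 3≤2*suc-m⇒1≤m (subst (3 ≤_) |R|≡ 3≤|R|)
      m≡1 : m ≡ 1
      m≡1 = ≤-antisym (4*m<6⇒m≤1 (≤-trans 4m<δ (≤-trans δ≤4+2νb (+-monoʳ-≤ 4 (*-monoʳ-≤ 2 νb≤1))))) 1≤m
      |R|≡4 : length R ≡ 4
      |R|≡4 = trans |R|≡ (cong (λ m → 2 * suc m) m≡1)
      b≁c : NonNeighbour b c
      b≁c with 1≤coDegree⇒nonNeighbour (R ∖ u) (1≤2*n⇒1≤n (+-cancelˡ-≤ 4 1 _ (subst (_≤ 4 + 2 * coDegree b (R ∖ u))
                 (cong (λ m → suc (4 * m)) m≡1) (≤-trans 4m<δ δ≤4+2νb))))
      ... | y , y∈ , b≁y = subst (NonNeighbour b) (nonNeighbours-of-b y∈ b≁y) b≁y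

  perfectMatchingOn-or-obstruction : ∀ m {R} → Unique R → length R ≡ 2 * suc m → coDegreeSum R + 2 ≤ 2 * length R →
    PerfectMatchingOn R ⊎ (∃ λ u → u ∈ R × Isolated R u) ⊎ (length R ≡ 4 × IndependentTriple)
  perfectMatchingOn-or-obstruction m {R} uR |R|≡ δ+2≤ with coDegreeSum R ≤? 4 * m
  ... | yes δ≤ = inj₁ (perfectMatchingOn-sparse m uR |R|≡ δ≤)
  ... | no δ≰ with search (λ u → 2 ≤? coDegree u R) R
  ...   | inj₂ ν≤1 = inj₂ (inj₁ (low-coDegree⇒isolated m uR |R|≡ (≰⇒> δ≰) (λ x∈R → s≤s⁻¹ (≰⇒> (ν≤1 x∈R)))))
  ...   | inj₁ (u , u∈R , 2≤νu) with neighbourOrIsolated u R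
  ...     | inj₂ isolated = inj₂ (inj₁ (u , u∈R , isolated))
  ...     | inj₁ (v , v∈R , u~v) with search (λ w → (adj G u w Bool.≟ true) ×-dec (1 ≤? coDegree w R)) R | 3 ≤? coDegree u R
  ...       | inj₁ (w , w∈R , u~w , 1≤νw) | _ =
                inj₁ (perfectMatchingOn-along-heavy-edge m uR |R|≡ δ+2≤ u∈R w∈R u~w (+-mono-≤ 2≤νu 1≤νw))
  ...       | inj₂ _ | yes 3≤νu =
                inj₁ (perfectMatchingOn-along-heavy-edge m uR |R|≡ δ+2≤ u∈R v∈R u~v (≤-trans 3≤νu (m≤m+n _ _)))
  ...       | inj₂ no-heavy-nbr | no 3≰νu with two-distinct (nonNeighbours-unique {u} uR) 2≤νu
  ...         | b , c , b∈ , c∈ , b≢c with ∈-nonNeighbours⁻ b∈ | ∈-nonNeighbours⁻ c∈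
  ...           | b∈R , u≁b | c∈R , u≁c = inj₂ (inj₂ (independentTriple m uR |R|≡ (≰⇒> δ≰) u∈R (s≤s⁻¹ (≰⇒> 3≰νu))
                    b∈R c∈R u≁b u≁c b≢c (λ w∈R u~w → n<1⇒n≡0 (≰⇒> (λ 1≤νw → no-heavy-nbr w∈R (u~w , 1≤νw))))))

module Exceptional {n} (G : Graph n) where

  open CoDegree G

  private
    vertices-unique : Unique (allFin n)
    vertices-unique = Unique.allFin⁺ n

    ⌊to≟to⌋ : ∀ (f : Fin n ↔ Fin n) i j → ⌊ Inverse.to f i Fin.≟ Inverse.to f j ⌋ ≡ ⌊ i Fin.≟ j ⌋
    ⌊to≟to⌋ f i j = ⌊⌋-cong (mk⇔ to-injective (cong (Inverse.to f))) _ _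
      where
      to-injective : Inverse.to f i ≡ Inverse.to f j → i ≡ j
      to-injective e = trans (sym (Inverse.strictlyInverseʳ f i)) (trans (cong (Inverse.from f) e) (Inverse.strictlyInverseʳ f j))

  -- All non-edges meet u, which has exactly n - 1 - 2k non-neighbours: list N(u), then the non-neighbours, then u.
  module _ (k h : ℕ) {u : Fin n} (n≡ : n ≡ 2 * k + 2 * suc h) (δ≤ : coDegreeSum (allFin n) ≤ 2 * suc (2 * h))
           (2h+1≤νu : suc (2 * h) ≤ coDegree u (allFin n)) where

    private
      all∖u-complete : Complete (allFin n ∖ u)
      all∖u-complete = coDegreeSum≡0⇒Complete (n≤0⇒n≡0 (+-cancelˡ-≤ (2 * coDegree u (allFin n)) _ 0 (begin
        2 * coDegree u (allFin n) + coDegreeSum (allFin n ∖ u) ≡⟨ coDegreeSum-∖ vertices-unique (∈-allFin u) ⟨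
        coDegreeSum (allFin n)                                ≤⟨ δ≤ ⟩
        2 * suc (2 * h)                                       ≤⟨ *-monoʳ-≤ 2 2h+1≤νu ⟩
        2 * coDegree u (allFin n)                             ≡⟨ +-identityʳ _ ⟨
        2 * coDegree u (allFin n) + 0                         ∎)))
        where open ≤-Reasoning
      νu≡ : coDegree u (allFin n) ≡ suc (2 * h)
      νu≡ = ≤-antisym (*-cancelˡ-≤ 2 (≤-trans (2*coDegree≤coDegreeSum vertices-unique (∈-allFin u)) δ≤)) 2h+1≤νu
      neighbour? : Decidable (λ x → adj G u x ≡ true)
      neighbour? x = adj G u x Bool.≟ true
      A N : List (Fin n)
      A = filter neighbour? (allFin n)
      N = nonNeighbours u (allFin n)
      ∈A⁻ : ∀ {x} → x ∈ A → adj G u x ≡ true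
      ∈A⁻ = proj₂ ∘ ∈-filter⁻ neighbour? {xs = allFin n}
      ∈N⁻ : ∀ {x} → x ∈ N → NonNeighbour u x
      ∈N⁻ = proj₂ ∘ ∈-nonNeighbours⁻ {R = allFin n}
      L-unique : Unique (A ++ N ++ [ u ])
      L-unique = Unique.++⁺ (Unique.filter⁺ neighbour? vertices-unique)
        (Unique.++⁺ (nonNeighbours-unique vertices-unique) ([] ∷ []) λ { (x∈N , here refl) → proj₁ (∈N⁻ x∈N) refl })
        λ (x∈A , x∈N++u) → case ∈-++⁻ N x∈N++u of λ where
          (inj₁ x∈N) → contradiction (trans (sym (∈A⁻ x∈A)) (proj₂ (∈N⁻ x∈N))) λ ()
          (inj₂ (here refl)) → contradiction (trans (sym (∈A⁻ x∈A)) (irrefl G u)) λ ()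
      cover : ∀ x → x ∈ A ++ N ++ [ u ]
      cover x with adj G u x in u~x | x Fin.≟ u
      ... | true | _ = ∈-++⁺ˡ (∈-filter⁺ neighbour? (∈-allFin x) u~x)
      ... | false | yes refl = ∈-++⁺ʳ A (∈-++⁺ʳ N (here refl))
      ... | false | no x≢u = ∈-++⁺ʳ A (∈-++⁺ˡ (∈-nonNeighbours⁺ (∈-allFin x) (x≢u , u~x)))
      open Listing L-unique cover
      |A|≡2k : length A ≡ 2 * k
      |A|≡2k = +-cancelʳ-≡ (2 * suc h) (length A) (2 * k) (begin
        length A + 2 * suc h          ≡⟨ cong (length A +_) (trans (cong (_+ 1) νu≡) (2*h+1+1≡2*suc-h h)) ⟨
        length A + (length N + 1)     ≡⟨ cong (length A +_) (length-++ N) ⟨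
        length A + length (N ++ [ u ]) ≡⟨ length-++ A ⟨
        length (A ++ N ++ [ u ])      ≡⟨ length≡n ⟩
        n                             ≡⟨ n≡ ⟩
        2 * k + 2 * suc h             ∎)
        where open ≡-Reasoning
      |A++N|≡n-1 : length (A ++ N) ≡ n ∸ 1
      |A++N|≡n-1 = begin
        length (A ++ N)                ≡⟨ m+n∸n≡m (length (A ++ N)) 1 ⟨
        length (A ++ N) + 1 ∸ 1        ≡⟨ cong (_∸ 1) (length-++ (A ++ N)) ⟨
        length ((A ++ N) ++ [ u ]) ∸ 1 ≡⟨ cong (λ xs → length xs ∸ 1) (++-assoc A N [ u ]) ⟩
        length (A ++ N ++ [ u ]) ∸ 1   ≡⟨ cong (_∸ 1) length≡n ⟩
        n ∸ 1                          ∎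
        where open ≡-Reasoning
      neighbour-position : ∀ x → (toℕ (Inverse.to position x) <ᵇ 2 * k) ≡ adj G u x
      neighbour-position x = <ᵇ≡ (mk⇔
        (λ x< → ∈A⁻ ((Equivalence.to (position-<⇔∈ A (N ++ [ u ]) refl x) (subst (toℕ (Inverse.to position x) <_) (sym |A|≡2k) x<))))
        (λ u~x → subst (toℕ (Inverse.to position x) <_) |A|≡2k
          (Equivalence.from (position-<⇔∈ A (N ++ [ u ]) refl x) (∈-filter⁺ neighbour? (∈-allFin x) u~x))))
      before-u : ∀ x → (toℕ (Inverse.to position x) <ᵇ n ∸ 1) ≡ not ⌊ x Fin.≟ u ⌋
      before-u x = <ᵇ≡ (mk⇔
        (λ x< → Equivalence.from (not⌊⌋≡true⇔ (x Fin.≟ u)) (λ x≡u → A++N-∌u (subst (_∈ A ++ N) x≡u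
           (Equivalence.to (position-<⇔∈ (A ++ N) [ u ] (sym (++-assoc A N [ u ])) x) (subst (toℕ (Inverse.to position x) <_) (sym |A++N|≡n-1) x<)))))
        (λ x≢u → subst (toℕ (Inverse.to position x) <_) |A++N|≡n-1 (Equivalence.from (position-<⇔∈ (A ++ N) [ u ] (sym (++-assoc A N [ u ])) x)
           (A++N-∋ x (Equivalence.to (not⌊⌋≡true⇔ (x Fin.≟ u)) x≢u)))))
        where
        A++N-∌u : u ∉ A ++ N
        A++N-∌u u∈ = case ∈-++⁻ A u∈ of λ where
          (inj₁ u∈A) → contradiction (trans (sym (∈A⁻ u∈A)) (irrefl G u)) λ ()
          (inj₂ u∈N) → proj₁ (∈N⁻ u∈N) refl
        A++N-∋ : ∀ x → x ≢ u → x ∈ A ++ N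
        A++N-∋ x x≢u with ∈-++⁻ A (cover x)
        ... | inj₁ x∈A = ∈-++⁺ˡ x∈A
        ... | inj₂ x∈N++u with ∈-++⁻ N x∈N++u
        ...   | inj₁ x∈N = ∈-++⁺ʳ A x∈N
        ...   | inj₂ (here x≡u) = contradiction x≡u x≢u
      structure : ∀ i j → adj G i j ≡ not ⌊ i Fin.≟ j ⌋ ∧ ((not ⌊ i Fin.≟ u ⌋ ∧ not ⌊ j Fin.≟ u ⌋) ∨ adj G u i ∨ adj G u j)
      structure i j with i Fin.≟ j
      ... | yes refl = irrefl G i
      ... | no i≢j with i Fin.≟ u | j Fin.≟ u
      ...   | yes refl | _ rewrite irrefl G i = refl
      ...   | no _ | yes refl rewrite irrefl G j | ∨-identityʳ (adj G j i) = symm G i j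
      ...   | no i≢u | no j≢u =
                ¬NonNeighbour⇒adjacent i≢j (all∖u-complete (∈-∖⁺ (∈-allFin i) i≢u) (∈-∖⁺ (∈-allFin j) j≢u))

    ≅Exc1 : G ≅ Exc1 n k
    ≅Exc1 = position , λ i j → trans (structure i j)
      (sym (cong₂ _∧_ (cong not (⌊to≟to⌋ position i j))
                      (cong₂ _∨_ (cong₂ _∧_ (before-u i) (before-u j)) (cong₂ _∨_ (neighbour-position i) (neighbour-position j)))))

  -- The complement of G is a triangle x y z plus isolated vertices: list all other vertices, then x, y, z.
  module _ (k : ℕ) (n≡ : n ≡ 2 * k + 4) (δ≤ : coDegreeSum (allFin n) ≤ 6) (triple : IndependentTriple) where

    private
      open IndependentTriple triple
      T : List (Fin n)
      T = x ∷ y ∷ z ∷ []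
      yz-unique : Unique (y ∷ z ∷ [])
      yz-unique = (proj₁ y≁z ∘ sym ∷ []) ∷ [] ∷ []
      T-unique : Unique T
      T-unique = (proj₁ x≁y ∘ sym ∷ proj₁ x≁z ∘ sym ∷ []) ∷ yz-unique
      y∈V∖x : y ∈ allFin n ∖ x
      y∈V∖x = ∈-∖⁺ (∈-allFin y) (proj₁ x≁y)
      bounds : 2 * coDegree x (allFin n) ≤ 4 × 2 * coDegree y (allFin n ∖ x) ≤ 2 × coDegreeSum (allFin n ∖ x ∖ y) ≡ 0
      bounds = triangle-bounds
        (*-monoʳ-≤ 2 (⊆-nonNeighbours⇒length-≤ yz-unique
          (λ { (here refl) → ∈-allFin y , x≁y ; (there (here refl)) → ∈-allFin z , x≁z })))
        (*-monoʳ-≤ 2 (nonNeighbour⇒1≤coDegree (∈-∖⁺ (∈-allFin z) (proj₁ x≁z)) y≁z))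
        (subst (_≤ 6) (trans (coDegreeSum-∖ vertices-unique (∈-allFin x))
                             (cong (2 * coDegree x (allFin n) +_) (coDegreeSum-∖ (∖-unique vertices-unique) y∈V∖x))) δ≤)
      on-triangle : ∀ {v w} → NonNeighbour v w → v ∈ T
      on-triangle {v} {w} v≁w with v Fin.≟ x | v Fin.≟ y | w Fin.≟ x | w Fin.≟ y
      ... | yes refl | _ | _ | _ = here refl
      ... | _ | yes refl | _ | _ = there (here refl)
      ... | no v≢x | no v≢y | yes refl | _
          with coDegree-≤⇒nonNeighbours⊆ yz-unique (λ { (here refl) → ∈-allFin y , x≁y ; (there (here refl)) → ∈-allFin z , x≁z })
                 (*-cancelˡ-≤ 2 (proj₁ bounds)) (∈-allFin v) (NonNeighbour-sym v≁w)
      ...   | here v≡y = contradiction v≡y v≢y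
      ...   | there v∈z = there (there v∈z)
      on-triangle {v} {w} v≁w | no v≢x | no v≢y | no w≢x | yes refl
          with coDegree-≤⇒nonNeighbours⊆ ([] ∷ []) (λ { (here refl) → ∈-∖⁺ (∈-allFin z) (proj₁ x≁z) , y≁z })
                 (*-cancelˡ-≤ 2 (proj₁ (proj₂ bounds))) (∈-∖⁺ (∈-allFin v) v≢x) (NonNeighbour-sym v≁w)
      ...   | v∈z = there (there v∈z)
      on-triangle {v} {w} v≁w | no v≢x | no v≢y | no w≢x | no w≢y = contradiction v≁w
        (coDegreeSum≡0⇒Complete (proj₂ (proj₂ bounds)) (∈-∖⁺ (∈-∖⁺ (∈-allFin v) v≢x) v≢y) (∈-∖⁺ (∈-∖⁺ (∈-allFin w) w≢x) w≢y))
      T-independent : ∀ {v w} → v ∈ T → w ∈ T → v ≢ w → adj G v w ≡ false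
      T-independent {v} {w} v∈T w∈T v≢w with v∈T | w∈T
      ... | here refl | here refl = contradiction refl v≢w
      ... | here refl | there (here refl) = proj₂ x≁y
      ... | here refl | there (there (here refl)) = proj₂ x≁z
      ... | there (here refl) | here refl = proj₂ (NonNeighbour-sym x≁y)
      ... | there (here refl) | there (here refl) = contradiction refl v≢w
      ... | there (here refl) | there (there (here refl)) = proj₂ y≁z
      ... | there (there (here refl)) | here refl = proj₂ (NonNeighbour-sym x≁z)
      ... | there (there (here refl)) | there (here refl) = proj₂ (NonNeighbour-sym y≁z)
      ... | there (there (here refl)) | there (there (here refl)) = contradiction refl v≢w
      A : List (Fin n)
      A = allFin n ∖∖ T
      L-unique : Unique (A ++ T)
      L-unique = Unique.++⁺ (∖∖-unique T vertices-unique) T-unique (λ (v∈A , v∈T) → proj₂ (∈-∖∖⁻ (allFin n) T v∈A) v∈T)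
      cover : ∀ v → v ∈ A ++ T
      cover v with v ∈? T
      ... | yes v∈T = ∈-++⁺ʳ A v∈T
      ... | no v∉T = ∈-++⁺ˡ (∈-∖∖⁺ T (∈-allFin v) v∉T)
      open Listing L-unique cover
      |A|≡2k+1 : length A ≡ 2 * k + 1
      |A|≡2k+1 = +-cancelʳ-≡ 3 (length A) (2 * k + 1) (begin
        length A + 3    ≡⟨ length-∖∖ T vertices-unique T-unique (λ {v} _ → ∈-allFin v) ⟩
        length (allFin n) ≡⟨ length-tabulate id ⟩
        n               ≡⟨ n≡ ⟩
        2 * k + 4       ≡⟨ +-assoc (2 * k) 1 3 ⟨
        2 * k + 1 + 3   ∎)
        where open ≡-Reasoning
      outside-position : ∀ v → (toℕ (Inverse.to position v) <ᵇ 2 * k + 1) ≡ not ⌊ v ∈? T ⌋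
      outside-position v = <ᵇ≡ (mk⇔
        (λ v< → Equivalence.from (not⌊⌋≡true⇔ (v ∈? T)) (proj₂ (∈-∖∖⁻ (allFin n) T
          (Equivalence.to (position-<⇔∈ A T refl v) (subst (toℕ (Inverse.to position v) <_) (sym |A|≡2k+1) v<)))))
        (λ v∉T → subst (toℕ (Inverse.to position v) <_) |A|≡2k+1 (Equivalence.from (position-<⇔∈ A T refl v)
          (∈-∖∖⁺ T (∈-allFin v) (Equivalence.to (not⌊⌋≡true⇔ (v ∈? T)) v∉T)))))
      structure : ∀ i j → adj G i j ≡ not ⌊ i Fin.≟ j ⌋ ∧ (not ⌊ i ∈? T ⌋ ∨ not ⌊ j ∈? T ⌋)
      structure i j with i Fin.≟ j
      ... | yes refl = irrefl G i
      ... | no i≢j with i ∈? T | j ∈? T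
      ...   | yes i∈T | yes j∈T = T-independent i∈T j∈T i≢j
      ...   | no i∉T | _ = ¬NonNeighbour⇒adjacent i≢j (i∉T ∘ on-triangle)
      ...   | yes _ | no j∉T = ¬NonNeighbour⇒adjacent i≢j (j∉T ∘ on-triangle ∘ NonNeighbour-sym)

    ≅CliqueJoinIndep : G ≅ CliqueJoinIndep n (2 * k + 1)
    ≅CliqueJoinIndep = position , λ i j → trans (structure i j)
      (sym (cong₂ _∧_ (cong not (⌊to≟to⌋ position i j)) (cong₂ _∨_ (outside-position i) (outside-position j))))

endpoints-++ : ∀ {n} (M P : List (Fin n × Fin n)) → endpoints (M ++ P) ≡ endpoints M ++ endpoints P
endpoints-++ = concatMap-++ (λ e → proj₁ e ∷ proj₂ e ∷ [])

length-endpoints : ∀ {n} (M : List (Fin n × Fin n)) → length (endpoints M) ≡ 2 * length M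
length-endpoints [] = refl
length-endpoints (e ∷ M) = trans (cong (suc ∘ suc) (length-endpoints M)) (sym (*-suc 2 (length M)))

module Extension {n} (G : Graph n) where

  open CoDegree G
  open PerfectMatchings G

  coDegreeSum-≤-of-numEdges : ∀ {e} → 1 ≤ n → (n ∸ 1) C 2 + e ≤ numEdges G → coDegreeSum (allFin n) + 2 * e ≤ 2 * (n ∸ 1)
  coDegreeSum-≤-of-numEdges {e} 1≤n dense = +-cancelˡ-≤ (2 * X) _ _ (begin
    2 * X + (coDegreeSum (allFin n) + 2 * e)  ≡⟨ rearrange X (coDegreeSum (allFin n)) e ⟩
    coDegreeSum (allFin n) + 2 * (X + e)      ≤⟨ +-monoʳ-≤ (coDegreeSum (allFin n)) (*-monoʳ-≤ 2 dense) ⟩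
    coDegreeSum (allFin n) + 2 * numEdges G   ≡⟨ coDegreeSum-allFin ⟩
    2 * (n C 2)                               ≡⟨ cong (2 *_) (C2-pred 1≤n) ⟩
    2 * (X + (n ∸ 1))                         ≡⟨ *-distribˡ-+ 2 X (n ∸ 1) ⟩
    2 * X + 2 * (n ∸ 1)                       ∎)
    where
    open ≤-Reasoning
    X = (n ∸ 1) C 2
    rearrange : ∀ x d e → 2 * x + (d + 2 * e) ≡ d + 2 * (x + e)
    rearrange = solve-∀

  Obstruction : ℕ → Set
  Obstruction h = (∃ λ u → suc (2 * h) ≤ coDegree u (allFin n)) ⊎ (h ≡ 1 × IndependentTriple)

  obstruction? : ∀ h → Dec (Obstruction h)
  obstruction? h = highCoDegree? ⊎-dec ((h ℕ.≟ 1) ×-dec independentTriple?)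
    where
    highCoDegree? : Dec (∃ λ u → suc (2 * h) ≤ coDegree u (allFin n))
    highCoDegree? with search (λ u → suc (2 * h) ≤? coDegree u (allFin n)) (allFin n)
    ... | inj₁ (u , _ , high) = yes (u , high)
    ... | inj₂ none = no λ (u , high) → none (∈-allFin u) high

  extension-or-obstruction : ∀ k h → n ≡ 2 * k + 2 * suc h → coDegreeSum (allFin n) ≤ 2 * suc (2 * h) →
    ∀ M → IsMatching G M → length M ≡ k → (∃ λ M′ → IsPerfectMatching G M′ × M ⊆ₘ M′) ⊎ Obstruction h
  extension-or-obstruction k h n≡ δ≤ M (M-adjacent , S-unique) |M|≡k =
    conclude (perfectMatchingOn-or-obstruction h R-unique |R|≡ δR+2≤)
    where
    S = endpoints M
    R = allFin n ∖∖ S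
    R-unique : Unique R
    R-unique = ∖∖-unique S (Unique.allFin⁺ n)
    |R|≡ : length R ≡ 2 * suc h
    |R|≡ = +-cancelʳ-≡ (length S) (length R) (2 * suc h) (begin
      length R + length S      ≡⟨ length-∖∖ S (Unique.allFin⁺ n) S-unique (λ {v} _ → ∈-allFin v) ⟩
      length (allFin n)        ≡⟨ length-tabulate id ⟩
      n                        ≡⟨ n≡ ⟩
      2 * k + 2 * suc h        ≡⟨ +-comm (2 * k) _ ⟩
      2 * suc h + 2 * k        ≡⟨ cong (λ m → 2 * suc h + 2 * m) |M|≡k ⟨
      2 * suc h + 2 * length M ≡⟨ cong (2 * suc h +_) (length-endpoints M) ⟨
      2 * suc h + length S     ∎)
      where open ≡-Reasoning
    δR+2≤ : coDegreeSum R + 2 ≤ 2 * length R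
    δR+2≤ = subst (coDegreeSum R + 2 ≤_) (trans (rearrange h) (cong (2 *_) (sym |R|≡)))
      (+-monoˡ-≤ 2 (≤-trans (coDegreeSum-∖∖-≤ S (Unique.allFin⁺ n)) δ≤))
      where
      rearrange : ∀ h → 2 * suc (2 * h) + 2 ≡ 2 * (2 * suc h)
      rearrange = solve-∀
    conclude : PerfectMatchingOn R ⊎ (∃ λ u → u ∈ R × Isolated R u) ⊎ (length R ≡ 4 × IndependentTriple) →
      (∃ λ M′ → IsPerfectMatching G M′ × M ⊆ₘ M′) ⊎ Obstruction h
    conclude (inj₁ pm) = inj₁ (M ++ matching , (M++P-matching , covered) , All.tabulate (inj₁ ∘ ∈-++⁺ˡ))
      where
      open PerfectMatchingOn pm
      M++P-matching : IsMatching G (M ++ matching)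
      M++P-matching = All.++⁺ M-adjacent (proj₁ isMatching)
                    , subst Unique (sym (endpoints-++ M matching))
                        (Unique.++⁺ S-unique (proj₂ isMatching)
                          (λ (v∈S , v∈P) → proj₂ (∈-∖∖⁻ (allFin n) S (covered⊆R v∈P)) v∈S))
      covered : ∀ v → v ∈ endpoints (M ++ matching)
      covered v with v ∈? S
      ... | yes v∈S = subst (v ∈_) (sym (endpoints-++ M matching)) (∈-++⁺ˡ v∈S)
      ... | no v∉S = subst (v ∈_) (sym (endpoints-++ M matching)) (∈-++⁺ʳ S (R⊆covered (∈-∖∖⁺ S (∈-allFin v) v∉S)))
    conclude (inj₂ (inj₁ (u , u∈R , isolated))) = inj₂ (inj₁ (u , ≤-trans
      (s≤s⁻¹ (subst (_≤ suc (coDegree u R)) (trans |R|≡ (*-suc 2 h)) (isolated⇒length-≤ R-unique u∈R isolated)))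
      (coDegree-mono R-unique (λ {v} _ → ∈-allFin v))))
    conclude (inj₂ (inj₂ (|R|≡4 , triple))) = inj₂ (inj₂ (suc-injective (*-cancelˡ-≡ (suc h) 2 2 (trans (sym |R|≡) |R|≡4)) , triple))

  kExtendable : ∀ k h → 1 ≤ k → n ≡ 2 * k + 2 * suc h → coDegreeSum (allFin n) ≤ 2 * suc (2 * h) →
    ¬ Obstruction h → KExtendable k G
  kExtendable k h 1≤k n≡ δ≤ ¬obstruction = 2k+2≤n , perfect , extends
    where
    2k+2≤n : n ≥ 2 * k + 2
    2k+2≤n = subst (2 * k + 2 ≤_) (sym n≡) (+-monoʳ-≤ (2 * k) (*-monoʳ-≤ 2 (s≤s z≤n)))
    perfect : HasPerfectMatching G
    perfect = matching , isMatching , λ v → R⊆covered (∈-allFin v)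
      where
      rearrange : ∀ k h → 2 * k + 2 * suc h ≡ 2 * suc (k + h)
      rearrange = solve-∀
      open PerfectMatchingOn (perfectMatchingOn-sparse (k + h) (Unique.allFin⁺ n)
        (trans (length-tabulate id) (trans n≡ (rearrange k h))) (≤-trans δ≤ (2*suc[2h]≤4*[k+h] h 1≤k)))
    extends : ∀ M → IsMatching G M → length M ≡ k → ∃ λ M′ → IsPerfectMatching G M′ × M ⊆ₘ M′
    extends M isMatching |M|≡k with extension-or-obstruction k h n≡ δ≤ M isMatching |M|≡k
    ... | inj₁ extension = extension
    ... | inj₂ obstruction = contradiction obstruction ¬obstruction

theorem1p1 : (k n : ℕ) → k ≥ 1 → n ≥ 1 → 2 ∣ n → (G : Graph n) → Connected G →
    numEdges G ≥ (n ∸ 1) C 2 + 2 * k →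
    KExtendable k G
      ⊎ G ≅ Exc1 n k ⊎ (n ≡ 2 * k + 4 × G ≅ CliqueJoinIndep n (2 * k + 1))
theorem1p1 k n 1≤k 1≤n (divides q n≡q*2) G _ dense =
  classify (even-parameters {k = k} {q = q} n≡q*2 1≤n (coDegreeSum-≤-of-numEdges 1≤n dense))
  where
  open CoDegree G
  open Exceptional G
  open Extension G
  classify : (∃ λ h → n ≡ 2 * k + 2 * suc h × coDegreeSum (allFin n) ≤ 2 * suc (2 * h)) →
    KExtendable k G ⊎ G ≅ Exc1 n k ⊎ (n ≡ 2 * k + 4 × G ≅ CliqueJoinIndep n (2 * k + 1))
  classify (h , n≡ , δ≤) with obstruction? h
  ... | yes (inj₁ (u , 2h+1≤νu)) = inj₂ (inj₁ (≅Exc1 k h n≡ δ≤ 2h+1≤νu))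
  ... | yes (inj₂ (refl , triple)) = inj₂ (inj₂ (n≡ , ≅CliqueJoinIndep k n≡ δ≤ triple))
  ... | no ¬obstruction = inj₁ (kExtendable k h 1≤k n≡ δ≤ ¬obstruction)
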